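{- Let $A$ be a finite subset of $M_n$. Then $\operatorname{Aut}(M_n/\operatorname{cl}(A))=W_{\operatorname{supp}(A)}\rtimes\operatorname{Sym}(\Omega\setminus\operatorname{supp}(A))$. Moreover, $\operatorname{Aut}(M_n/\operatorname{cl}(A))$ is the unique minimal closed subgroup of finite index of $\operatorname{Aut}(M_n/A)$.
   Context: Let $n\geq 2$ and $\Omega$ a countably infinite set. $[X]^m$ is the set of $m$-subsets of $X$; $\mathbb{F}_2^{[\Omega]^m}$ the group of functions $[\Omega]^m\to\mathbb{F}_2$, with $\operatorname{Sym}(\Omega)$ acting by $f^\sigma(w)=f(w^{\sigma^{ -1}})$. $\beta^\ast_{n,n-1}:\mathbb{F}_2^{[\Omega]^{n-1}}\to\mathbb{F}_2^{[\Omega]^n}$, $(\beta^\ast_{n,n-1}f)(\omega)=\sum_{x\in[\omega]^{n-1}}f(x)$. $M_n$ is the countable multisorted structure with sorts $\Omega$, $[\Omega]^n$, $[\Omega]^n\times\mathbb{F}_2$ whose automorphism group is $G=\operatorname{Im}\beta^\ast_{n,n-1}\rtimes\operatorname{Sym}(\Omega)$ (e.g. with the $G$-orbits on finite tuples as basic relations), where $g\sigma$ ($g\in\operatorname{Im}\beta^\ast_{n,n-1}$, $\sigma\in\operatorname{Sym}(\Omega)$) acts on $\Omega$ and $[\Omega]^n$ via $\sigma$ and by $(w,x)^{g\sigma}=(w^\sigma,x+g(w))$ on $[\Omega]^n\times\mathbb{F}_2$; groups carry the topology of pointwise convergence. $\operatorname{Aut}(M_n/X)$ is the pointwise stabilizer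 of $X$. For finite $A\subseteq M_n$ write $A=A_1\cup A_2\cup A_3$ with $A_1,A_2,A_3$ in the sorts $\Omega$, $[\Omega]^n$, $[\Omega]^n\times\mathbb{F}_2$ respectively; $\operatorname{supp}(A)=A_1\cup\bigcup A_2\cup\bigcup\pi(A_3)\subseteq\Omega$, where $\pi$ is projection to the first coordinate; $\operatorname{cl}(A)=\operatorname{supp}(A)\cup[\operatorname{supp}(A)]^n\cup([\operatorname{supp}(A)]^n\times\mathbb{F}_2)$. For finite $S\subseteq\Omega$: $\operatorname{Sym}(\Omega\setminus S)$ is the pointwise stabilizer of $S$ in $\operatorname{Sym}(\Omega)$; for $B\subseteq S$, $V_{B,S}=\{f\in\mathbb{F}_2^{[\Omega]^{n-1}}: f(w)=0\text{ whenever }w\cap S\neq B\}$, $V_S=\bigoplus_{B\subseteq S,|B|<n-1}V_{B,S}$, and $W_S=\beta^\ast_{n,n-1}(V_S)$. -}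

module Defs where

open import Data.Nat using (ℕ; _<_; _≤_)
open import Data.Nat.Properties using (≤-decTotalOrder)
open import Data.Bool using (Bool; true; false; _xor_)
open import Data.List using (List; []; _∷_; map; foldr; length; concatMap)
open import Data.List.Membership.Propositional using (_∈_)
open import Data.List.Relation.Unary.Linked using (Linked)
open import Data.List.Relation.Unary.All using (All)
open import Data.Product using (Σ; ∃; _×_; _,_)
open import Data.Unit using (⊤)
open import Function using (_↔_; Inverse)
open import Relation.Binary.PropositionalEquality using (_≡_; _≢_)
open import Relation.Nullary using (¬_)
import Data.List.Sort.InsertionSort as InsSort

-- Ω = ℕ (a countably infinite set); F₂ = Bool with xor as addition.
-- A finite subset of Ω is represented by the strictly increasing list
-- of its elements; [Ω]^m = strictly increasing lists of length m.

Incr : List ℕ → Set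
Incr = Linked _<_

IsMSet : ℕ → List ℕ → Set
IsMSet m w = Incr w × length w ≡ m

sortℕ : List ℕ → List ℕ
sortℕ = InsSort.sort ≤-decTotalOrder

Perm : Set
Perm = ℕ ↔ ℕ

app : Perm → ℕ → ℕ
app σ = Inverse.to σ

imgSet : Perm → List ℕ → List ℕ
imgSet σ w = sortℕ (map (app σ) w)

removals : List ℕ → List (List ℕ)
removals []       = []
removals (x ∷ xs) = xs ∷ map (x ∷_) (removals xs)

xorSum : List Bool → Bool
xorSum = foldr _xor_ false

-- functions [Ω]^{n-1} → F₂ (only values on (n-1)-sets matter)
Fn : Set
Fn = List ℕ → Bool

betaStar : Fn → List ℕ → Bool
betaStar f ω = xorSum (map f (removals ω))

data Pt : Set where
  pt   : ℕ → Pt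
  nset : List ℕ → Pt
  pair : List ℕ → Bool → Pt

-- a point is a genuine element of M_n
Valid : ℕ → Pt → Set
Valid n (pt x)     = ⊤
Valid n (nset w)   = IsMSet n w
Valid n (pair w b) = IsMSet n w

-- Elements of G = Im β*_{n,n-1} ⋊ Sym(Ω): the element g σ with
-- g = β* f.  (The decomposition is written via a preimage f of g.)
record Elt : Set where
  constructor mkElt
  field
    fn  : Fn
    sym : Perm
open Elt public

act : Elt → Pt → Pt
act e (pt x)     = pt (app (sym e) x)
act e (nset w)   = nset (imgSet (sym e) w)
act e (pair w b) = pair (imgSet (sym e) w) (b xor betaStar (fn e) w)

Fixes : ℕ → (Pt → Set) → Elt → Set
Fixes n X e = ∀ m → Valid n m → X m → act e m ≡ m

suppPt : Pt → List ℕ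
suppPt (pt x)     = x ∷ []
suppPt (nset w)   = w
suppPt (pair w b) = w

supp : List Pt → List ℕ
supp A = concatMap suppPt A

InList : List Pt → Pt → Set
InList A m = m ∈ A

cl : List Pt → Pt → Set
cl A (pt x)     = x ∈ supp A
cl A (nset w)   = All (_∈ supp A) w
cl A (pair w b) = All (_∈ supp A) w

InterEq : List ℕ → List ℕ → List ℕ → Set
InterEq w S B = ∀ x → ((x ∈ w × x ∈ S) → x ∈ B) × (x ∈ B → (x ∈ w × x ∈ S))

V : ℕ → List ℕ → List ℕ → Fn → Set
V m B S f = ∀ w → IsMSet m w → ¬ InterEq w S B → f w ≡ false

-- V_S = ⊕_{B ⊆ S, |B| < n-1} V_{B,S} : the (internal) sum, i.e. f is a
-- finite sum of elements φᵢ ∈ V_{Bᵢ,S} with Bᵢ ⊆ S, |Bᵢ| < n-1.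
-- (Here m = n-1.)
VS : ℕ → List ℕ → Fn → Set
VS m S f = Σ (List (List ℕ × Fn)) λ comps →
  All (λ { (B , φ) → Incr B × All (_∈ S) B × length B < m × V m B S φ }) comps
  × (∀ w → f w ≡ xorSum (map (λ { (B , φ) → φ w }) comps))

InWSSym : ℕ → List ℕ → Elt → Set
InWSSym m S e =
  (∀ x → x ∈ S → app (sym e) x ≡ x)
  × Σ Fn (λ v → VS m S v × (∀ w → IsMSet (Data.Nat.suc m) w → betaStar (fn e) w ≡ betaStar v w))

SameAct : ℕ → Elt → Elt → Set
SameAct n g h = ∀ m → Valid n m → act g m ≡ act h m

record IsSubgroupOf (n : ℕ) (H K : Elt → Set) : Set where
  field
    sub     : ∀ g → H g → K g
    resp    : ∀ g h → H g → SameAct n g h → H h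
    hasId   : Σ Elt λ e → H e × (∀ m → Valid n m → act e m ≡ m)
    hasMul  : ∀ g h → H g → H h →
              Σ Elt λ k → H k × (∀ m → Valid n m → act k m ≡ act h (act g m))
    hasInv  : ∀ g → H g →
              Σ Elt λ k → H k × (∀ m → Valid n m → act k (act g m) ≡ m)

-- closed in the topology of pointwise convergence
IsClosed : ℕ → (Elt → Set) → Set
IsClosed n H = ∀ g →
  (∀ (L : List Pt) → All (Valid n) L →
     Σ Elt λ h → H h × All (λ m → act h m ≡ act g m) L) → H g

FiniteIndexIn : ℕ → (Elt → Set) → (Elt → Set) → Set
FiniteIndexIn n H K = Σ (List Elt) λ reps → All K reps ×
  (∀ k → K k → Σ Elt λ r → r ∈ reps × Σ Elt λ h → H h ×
     (∀ m → Valid n m → act k m ≡ act h (act r m)))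

-- An element g σ fixes cl(A) pointwise iff σ fixes S = supp A pointwise and g vanishes
-- on [S]^n. Writing g = β* f, the cone over a point of S (a contracting homotopy, since
-- β* ∘ β* = 0) changes f within the fibre of β* until it vanishes on [S]^{n-1}; split
-- along the traces w ∩ S it then lies in V_S. Modulo this stabiliser an element of
-- Aut(M_n/A) is determined by the finitely many data σ|S (with values in S) and g on [S]^n,
-- so the index is finite. Conversely, a closed subgroup H of finite index k contains y^{k!}
-- for every y ∈ Aut(M_n/A). Transpositions of points outside S and translations β*δ_u
-- with u ⊄ S agree on any given finite set with such powers of elements built from long
-- cycles beyond that set, and they generate Aut(M_n/cl A) topologically.

module Submission where

open import Defs renaming (sym to perm)
open import Algebra.Bundles using (CommutativeRing)
open import Data.Bool using (Bool; true; false; _xor_; _∧_; if_then_else_)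
open import Data.Bool.Properties
  using (xor-∧-commutativeRing; xor-assoc; xor-comm; xor-identityʳ; xor-same; ∧-identityʳ; ∧-zeroʳ; ∧-distribʳ-xor)
  renaming (_≟_ to _≟B_)
open import Data.Empty using (⊥; ⊥-elim)
open import Data.Fin using (Fin; toℕ)
import Data.Fin.Properties as Fin
open import Data.List
  using (List; []; _∷_; map; foldr; length; filter; _++_; concatMap; cartesianProduct; upTo; lookup)
import Data.List.Properties as List
open import Data.List.Membership.Propositional using (_∈_; _∉_; find)
open import Data.List.Membership.Propositional.Properties
  using (∈-map⁺; ∈-map⁻; ∈-filter⁺; ∈-filter⁻; ∈-++⁺ˡ; ∈-++⁺ʳ; ∈-++⁻; ∈-upTo⁺;
         ∈-concatMap⁺; ∈-cartesianProduct⁺)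
open import Data.List.Relation.Binary.Permutation.Propositional using (_↭_; ↭-sym; ↭⇒↭ₛ)
import Data.List.Relation.Binary.Permutation.Propositional.Properties as Perm
open import Data.List.Relation.Binary.Permutation.Setoid.Properties using (foldr-commMonoid; Unique-resp-↭)
open import Data.List.Relation.Unary.All using (All; []; _∷_; all?)
import Data.List.Relation.Unary.All as All
import Data.List.Relation.Unary.All.Properties as All
open import Data.List.Relation.Unary.Any using (Any; here; there; index)
import Data.List.Relation.Unary.Any as Any
open import Data.List.Relation.Unary.Any.Properties using (lookup-index)
open import Data.List.Relation.Unary.AllPairs using ([]; _∷_)
import Data.List.Relation.Unary.AllPairs as AllPairs
open import Data.List.Relation.Unary.Linked using (Linked; []; [-]; _∷_)
import Data.List.Relation.Unary.Linked as Linked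
import Data.List.Relation.Unary.Linked.Properties as Linked
open import Data.List.Relation.Unary.Unique.Propositional using (Unique)
import Data.List.Relation.Unary.Unique.Propositional.Properties as Unique
import Data.List.Sort.InsertionSort.Properties
open import Data.Nat
  using (ℕ; zero; suc; pred; _<_; _≤_; _≟_; _<?_; _∸_; _+_; _*_; _!; _⊔_; s≤s)
open import Data.Nat.Divisibility using (_∣_; divides; ∣-trans; m≤n⇒m!∣n!)
open import Data.Nat.Properties
open import Data.Product using (Σ; ∃; _×_; _,_; proj₁; proj₂)
open import Data.Sum using (_⊎_; inj₁; inj₂; [_,_])
open import Data.Unit using (tt)
open import Function using (_∘_; id; _⇔_; mk⇔; Equivalence; case_of_)
open import Function.Bundles using (Inverse; mk↔ₛ′)
open import Relation.Binary.PropositionalEquality hiding ([_]; resp)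
open import Relation.Binary.Definitions using (tri<; tri≈; tri>)
open import Relation.Nullary using (¬_; Dec; yes; no; ¬?; does)
open import Relation.Nullary.Decidable using (dec-true; dec-false)

module SortP = Data.List.Sort.InsertionSort.Properties ≤-decTotalOrder
module XorRing = CommutativeRing xor-∧-commutativeRing
open import Algebra.Properties.CommutativeSemigroup XorRing.+-commutativeSemigroup
  using (x∙yz≈y∙xz)
open import Data.List.Membership.DecPropositional _≟_ using (_∈?_)
open import Data.List.Membership.DecPropositional (List.≡-dec _≟_) using () renaming (_∈?_ to _∈ₗ?_)

_≟ₗ_ : (u w : List ℕ) → Dec (u ≡ w)
_≟ₗ_ = List.≡-dec _≟_

-- Finite subsets of Ω as increasing lists

incr-head< : ∀ {y ys z} → Incr (y ∷ ys) → z ∈ ys → y < z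
incr-head< (r ∷ p) (here refl)  = r
incr-head< (r ∷ p) (there z∈)   = <-trans r (incr-head< p z∈)

incr-head∉ : ∀ {y ys} → Incr (y ∷ ys) → y ∉ ys
incr-head∉ p y∈ = <-irrefl refl (incr-head< p y∈)

incr-ext : ∀ {xs ys} → Incr xs → Incr ys →
  (∀ z → z ∈ xs → z ∈ ys) → (∀ z → z ∈ ys → z ∈ xs) → xs ≡ ys
incr-ext {[]}     {[]}     p q f g = refl
incr-ext {[]}     {y ∷ ys} p q f g with () ← g y (here refl)
incr-ext {x ∷ xs} {[]}     p q f g with () ← f x (here refl)
incr-ext {x ∷ xs} {y ∷ ys} p q f g with heads
  where
  heads : x ≡ y
  heads with f x (here refl) | g y (here refl)
  ... | here e  | _       = e
  ... | there _ | here e  = sym e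
  ... | there a | there b = ⊥-elim (<-asym (incr-head< q a) (incr-head< p b))
... | refl = cong (x ∷_) (incr-ext (Linked.tail p) (Linked.tail q) (tails p f) (tails q g))
  where
  tails : ∀ {as bs} → Incr (x ∷ as) → (∀ z → z ∈ x ∷ as → z ∈ x ∷ bs) → ∀ z → z ∈ as → z ∈ bs
  tails p h z z∈ with h z (there z∈)
  ... | here refl = ⊥-elim (incr-head∉ p z∈)
  ... | there z∈′ = z∈′

incr⇒unique : ∀ {xs} → Incr xs → Unique xs
incr⇒unique p = AllPairs.map (λ x<y x≡y → <-irrefl x≡y x<y) (Linked.Linked⇒AllPairs <-trans p)

sorted-unique⇒incr : ∀ {xs} → Linked _≤_ xs → Unique xs → Incr xs
sorted-unique⇒incr []      _                  = []
sorted-unique⇒incr [-]     _                  = [-]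
sorted-unique⇒incr (r ∷ l) ((x≢y ∷ _) ∷ d)   = ≤∧≢⇒< r x≢y ∷ sorted-unique⇒incr l d

unique-↭ : ∀ {xs ys : List ℕ} → xs ↭ ys → Unique xs → Unique ys
unique-↭ p = Unique-resp-↭ (setoid ℕ) (↭⇒↭ₛ p)

sort-incr : ∀ {xs} → Unique xs → Incr (sortℕ xs)
sort-incr {xs} u = sorted-unique⇒incr (SortP.sort-↗ xs) (unique-↭ (↭-sym (SortP.sort-↭ xs)) u)

∈-sort⁺ : ∀ {xs z} → z ∈ xs → z ∈ sortℕ xs
∈-sort⁺ {xs} = Perm.∈-resp-↭ (↭-sym (SortP.sort-↭ xs))

∈-sort⁻ : ∀ {xs z} → z ∈ sortℕ xs → z ∈ xs
∈-sort⁻ {xs} = Perm.∈-resp-↭ (SortP.sort-↭ xs)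

-- Sums in F₂

map-cong∈ : ∀ {A B : Set} {f g : A → B} xs → (∀ x → x ∈ xs → f x ≡ g x) → map f xs ≡ map g xs
map-cong∈ xs h = List.map-cong-local (All.tabulate (h _))

xorSum-↭ : ∀ {xs ys} → xs ↭ ys → xorSum xs ≡ xorSum ys
xorSum-↭ p = foldr-commMonoid (setoid Bool) XorRing.+-isCommutativeMonoid (↭⇒↭ₛ p)

xorSum-++ : ∀ xs ys → xorSum (xs ++ ys) ≡ xorSum xs xor xorSum ys
xorSum-++ []       ys = refl
xorSum-++ (x ∷ xs) ys = trans (cong (x xor_) (xorSum-++ xs ys)) (sym (xor-assoc x _ _))

xorSum-map-xor : ∀ {A : Set} (f g : A → Bool) xs →
  xorSum (map (λ x → f x xor g x) xs) ≡ xorSum (map f xs) xor xorSum (map g xs)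
xorSum-map-xor f g []       = refl
xorSum-map-xor f g (x ∷ xs) = begin
  (f x xor g x) xor xorSum (map (λ x → f x xor g x) xs)
    ≡⟨ cong ((f x xor g x) xor_) (xorSum-map-xor f g xs) ⟩
  (f x xor g x) xor (F xor G)  ≡⟨ xor-assoc (f x) (g x) _ ⟩
  f x xor (g x xor (F xor G))  ≡⟨ cong (f x xor_) (x∙yz≈y∙xz (g x) F G) ⟩
  f x xor (F xor (g x xor G))  ≡⟨ sym (xor-assoc (f x) F _) ⟩
  (f x xor F) xor (g x xor G)  ∎
  where
  open ≡-Reasoning
  F = xorSum (map f xs)
  G = xorSum (map g xs)

xorSum-false : ∀ {A : Set} (f : A → Bool) xs → All (λ x → f x ≡ false) xs → xorSum (map f xs) ≡ false
xorSum-false f []       []       = refl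
xorSum-false f (x ∷ xs) (p ∷ ps) rewrite p = xorSum-false f xs ps

xorSum-single : ∀ (g : ℕ → Bool) y {w} → Incr w → y ∈ w →
  (∀ z → z ∈ w → z ≢ y → g z ≡ false) → xorSum (map g w) ≡ g y
xorSum-single g y {x ∷ xs} p (here refl) h =
  trans (cong (g x xor_) (xorSum-false g xs (All.tabulate λ z∈ → h _ (there z∈) (λ { refl → incr-head∉ p z∈ }))))
        (xor-identityʳ _)
xorSum-single g y {x ∷ xs} p (there y∈) h =
  trans (cong (_xor xorSum (map g xs)) (h x (here refl) (λ { refl → incr-head∉ p y∈ })))
        (xorSum-single g y (Linked.tail p) y∈ (λ z z∈ → h z (there z∈)))

app⁻¹ : Perm → ℕ → ℕ
app⁻¹ σ = Inverse.from σ

app-app⁻¹ : ∀ σ x → app σ (app⁻¹ σ x) ≡ x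
app-app⁻¹ σ = Inverse.strictlyInverseˡ σ

app⁻¹-app : ∀ σ x → app⁻¹ σ (app σ x) ≡ x
app⁻¹-app σ = Inverse.strictlyInverseʳ σ

app-injective : ∀ σ {x y} → app σ x ≡ app σ y → x ≡ y
app-injective σ {x} {y} e = trans (sym (app⁻¹-app σ x)) (trans (cong (app⁻¹ σ) e) (app⁻¹-app σ y))

imgSet-↭ : ∀ σ w → imgSet σ w ↭ map (app σ) w
imgSet-↭ σ w = SortP.sort-↭ (map (app σ) w)

imgSet-incr : ∀ σ {w} → Incr w → Incr (imgSet σ w)
imgSet-incr σ p = sort-incr (Unique.map⁺ (app-injective σ) (incr⇒unique p))

imgSet-∈⁺ : ∀ σ {w x} → x ∈ w → app σ x ∈ imgSet σ w
imgSet-∈⁺ σ x∈ = ∈-sort⁺ (∈-map⁺ (app σ) x∈)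

imgSet-∈⁻ : ∀ σ {w z} → z ∈ imgSet σ w → ∃ λ x → x ∈ w × z ≡ app σ x
imgSet-∈⁻ σ z∈ = ∈-map⁻ (app σ) (∈-sort⁻ z∈)

imgSet-length : ∀ σ w → length (imgSet σ w) ≡ length w
imgSet-length σ w = trans (Perm.↭-length (imgSet-↭ σ w)) (List.length-map (app σ) w)

imgSet-cong : ∀ σ τ {w} → Incr w → (∀ x → x ∈ w → app σ x ≡ app τ x) → imgSet σ w ≡ imgSet τ w
imgSet-cong σ τ {w} p h = incr-ext (imgSet-incr σ p) (imgSet-incr τ p) (⊆ σ τ h) (⊆ τ σ (λ x x∈ → sym (h x x∈)))
  where
  ⊆ : ∀ σ τ → (∀ x → x ∈ w → app σ x ≡ app τ x) → ∀ z → z ∈ imgSet σ w → z ∈ imgSet τ w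
  ⊆ σ τ h z z∈ with imgSet-∈⁻ σ z∈
  ... | x , x∈ , refl = subst (_∈ imgSet τ w) (sym (h x x∈)) (imgSet-∈⁺ τ x∈)

imgSet-fixed : ∀ σ {w} → Incr w → (∀ x → x ∈ w → app σ x ≡ x) → imgSet σ w ≡ w
imgSet-fixed σ {w} p h = incr-ext (imgSet-incr σ p) p to from
  where
  to : ∀ z → z ∈ imgSet σ w → z ∈ w
  to z z∈ with imgSet-∈⁻ σ z∈
  ... | x , x∈ , refl = subst (_∈ w) (sym (h x x∈)) x∈
  from : ∀ z → z ∈ w → z ∈ imgSet σ w
  from z z∈ = subst (_∈ imgSet σ w) (h z z∈) (imgSet-∈⁺ σ z∈)

-- Removing one point, and β*

opaque
  delete : ℕ → List ℕ → List ℕ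
  delete y = filter (λ z → ¬? (z ≟ y))

  delete-incr : ∀ y {s} → Incr s → Incr (delete y s)
  delete-incr y = Linked.filter⁺ (λ z → ¬? (z ≟ y)) <-trans

  ∈-delete⁺ : ∀ {y s z} → z ∈ s → z ≢ y → z ∈ delete y s
  ∈-delete⁺ {y} = ∈-filter⁺ (λ z → ¬? (z ≟ y))

  ∈-delete⁻ : ∀ {y s z} → z ∈ delete y s → z ∈ s × z ≢ y
  ∈-delete⁻ {y} = ∈-filter⁻ (λ z → ¬? (z ≟ y))

  delete-∉ : ∀ {y s} → y ∉ s → delete y s ≡ s
  delete-∉ {y} {s} y∉ = List.filter-all (λ z → ¬? (z ≟ y)) (All.tabulate λ {z} z∈ z≡y → y∉ (subst (_∈ s) z≡y z∈))

  delete-∷ : ∀ {y x s} → x ≢ y → delete y (x ∷ s) ≡ x ∷ delete y s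
  delete-∷ {y} = List.filter-accept (λ z → ¬? (z ≟ y))

  delete-head : ∀ {x s} → delete x (x ∷ s) ≡ delete x s
  delete-head {x} = List.filter-reject (λ z → ¬? (z ≟ x)) (λ f → f refl)

  delete-comm : ∀ y z w → delete z (delete y w) ≡ delete y (delete z w)
  delete-comm y z [] = refl
  delete-comm y z (x ∷ w) with x ≟ y | x ≟ z
  ... | yes refl | yes refl = refl
  ... | yes refl | no x≢z = begin
    delete z (delete x (x ∷ w))  ≡⟨ cong (delete z) (delete-head {x} {w}) ⟩
    delete z (delete x w)        ≡⟨ delete-comm x z w ⟩
    delete x (delete z w)        ≡⟨ sym (delete-head {x} {delete z w}) ⟩
    delete x (x ∷ delete z w)    ≡⟨ cong (delete x) (sym (delete-∷ {z} {x} {w} x≢z)) ⟩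
    delete x (delete z (x ∷ w))  ∎
    where open ≡-Reasoning
  ... | no x≢y | yes refl = begin
    delete x (delete y (x ∷ w))  ≡⟨ cong (delete x) (delete-∷ {y} {x} {w} x≢y) ⟩
    delete x (x ∷ delete y w)    ≡⟨ delete-head {x} {delete y w} ⟩
    delete x (delete y w)        ≡⟨ delete-comm y x w ⟩
    delete y (delete x w)        ≡⟨ cong (delete y) (sym (delete-head {x} {w})) ⟩
    delete y (delete x (x ∷ w))  ∎
    where open ≡-Reasoning
  ... | no x≢y | no x≢z = begin
    delete z (delete y (x ∷ w))  ≡⟨ cong (delete z) (delete-∷ {y} {x} {w} x≢y) ⟩
    delete z (x ∷ delete y w)    ≡⟨ delete-∷ {z} {x} {delete y w} x≢z ⟩
    x ∷ delete z (delete y w)    ≡⟨ cong (x ∷_) (delete-comm y z w) ⟩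
    x ∷ delete y (delete z w)    ≡⟨ sym (delete-∷ {y} {x} {delete z w} x≢y) ⟩
    delete y (x ∷ delete z w)    ≡⟨ cong (delete y) (sym (delete-∷ {z} {x} {w} x≢z)) ⟩
    delete y (delete z (x ∷ w))  ∎
    where open ≡-Reasoning

suc-length-delete : ∀ {y s} → Incr s → y ∈ s → suc (length (delete y s)) ≡ length s
suc-length-delete {y} {x ∷ s} p (here refl) = cong (suc ∘ length) (trans delete-head (delete-∉ (incr-head∉ p)))
suc-length-delete {y} {x ∷ s} p (there y∈) =
  trans (cong (suc ∘ length) (delete-∷ λ { refl → incr-head∉ p y∈ }))
        (cong suc (suc-length-delete (Linked.tail p) y∈))

removals≡map-delete : ∀ {s} → Incr s → removals s ≡ map (λ y → delete y s) s
removals≡map-delete {[]}     p = refl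
removals≡map-delete {x ∷ xs} p = cong₂ _∷_
  (sym (trans delete-head (delete-∉ (incr-head∉ p))))
  (begin
    map (x ∷_) (removals xs)                 ≡⟨ cong (map (x ∷_)) (removals≡map-delete (Linked.tail p)) ⟩
    map (x ∷_) (map (λ y → delete y xs) xs)  ≡⟨ sym (List.map-∘ xs) ⟩
    map (λ y → x ∷ delete y xs) xs           ≡⟨ map-cong∈ xs (λ y y∈ → sym (delete-∷ λ { refl → incr-head∉ p y∈ })) ⟩
    map (λ y → delete y (x ∷ xs)) xs            ∎)
  where open ≡-Reasoning

∈-removals⁻ : ∀ {s r} → Incr s → r ∈ removals s → ∃ λ y → y ∈ s × r ≡ delete y s
∈-removals⁻ {s} p r∈ = ∈-map⁻ (λ y → delete y s) (subst (_ ∈_) (removals≡map-delete p) r∈)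

removals-incr : ∀ {w u} → Incr w → u ∈ removals w → Incr u
removals-incr p u∈ with ∈-removals⁻ p u∈
... | y , _ , refl = delete-incr y p

removals-mset : ∀ {m w u} → IsMSet (suc m) w → u ∈ removals w → IsMSet m u
removals-mset (p , l) u∈ with ∈-removals⁻ p u∈
... | y , y∈ , refl = delete-incr y p , suc-injective (trans (suc-length-delete p y∈) l)

removals-⊆ : ∀ {w u z} → Incr w → u ∈ removals w → z ∈ u → z ∈ w
removals-⊆ p u∈ z∈ with ∈-removals⁻ p u∈
... | y , _ , refl = proj₁ (∈-delete⁻ z∈)

betaStar-delete : ∀ f {s} → Incr s → betaStar f s ≡ xorSum (map (λ y → f (delete y s)) s)
betaStar-delete f {s} p = trans (cong (xorSum ∘ map f) (removals≡map-delete p)) (cong xorSum (sym (List.map-∘ s)))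

betaStar-cong : ∀ f g w → (∀ u → u ∈ removals w → f u ≡ g u) → betaStar f w ≡ betaStar g w
betaStar-cong f g w h = cong xorSum (map-cong∈ (removals w) h)

betaStar-xor : ∀ f g w → betaStar (λ u → f u xor g u) w ≡ betaStar f w xor betaStar g w
betaStar-xor f g w = xorSum-map-xor f g (removals w)

betaStar-zero : ∀ w → betaStar (λ _ → false) w ≡ false
betaStar-zero w = xorSum-false (λ _ → false) (removals w) (All.tabulate λ _ → refl)

-- β* ∘ β* = 0: each (|w|-2)-subset of w arises from exactly two orders of removal.
betaStar² : ∀ t {w} → Incr w → betaStar (betaStar t) w ≡ false
betaStar² t {w} p = begin
  betaStar (betaStar t) w                                 ≡⟨ betaStar-delete (betaStar t) p ⟩
  xorSum (map (λ y → betaStar t (delete y w)) w)          ≡⟨ cong xorSum (map-cong∈ w (λ y _ → betaStar-delete t (delete-incr y p))) ⟩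
  xorSum (map (λ y → xorSum (map (G y) (delete y w))) w)  ≡⟨ pairs-cancel p ⟩
  false                                                   ∎
  where
  open ≡-Reasoning
  G : ℕ → ℕ → Bool
  G y z = t (delete z (delete y w))
  G-sym : ∀ y z → G y z ≡ G z y
  G-sym y z = cong t (delete-comm y z w)
  pairs-cancel : ∀ {s} → Incr s → xorSum (map (λ y → xorSum (map (G y) (delete y s))) s) ≡ false
  pairs-cancel {[]} p = refl
  pairs-cancel {x ∷ xs} p = begin
    xorSum (map (G x) (delete x (x ∷ xs))) xor xorSum (map (λ y → xorSum (map (G y) (delete y (x ∷ xs)))) xs)
      ≡⟨ cong₂ _xor_ (cong (xorSum ∘ map (G x)) (trans delete-head (delete-∉ (incr-head∉ p))))
                     (cong xorSum (map-cong∈ xs (λ y y∈ → cong (xorSum ∘ map (G y)) (delete-∷ λ { refl → incr-head∉ p y∈ })))) ⟩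
    Gx xor xorSum (map (λ y → G y x xor xorSum (map (G y) (delete y xs))) xs)
      ≡⟨ cong (Gx xor_) (xorSum-map-xor (λ y → G y x) _ xs) ⟩
    Gx xor (xorSum (map (λ y → G y x) xs) xor xorSum (map (λ y → xorSum (map (G y) (delete y xs))) xs))
      ≡⟨ cong₂ (λ a b → Gx xor (a xor b)) (cong xorSum (map-cong∈ xs (λ y _ → G-sym y x))) (pairs-cancel (Linked.tail p)) ⟩
    Gx xor (Gx xor false)  ≡⟨ cong (Gx xor_) (xor-identityʳ Gx) ⟩
    Gx xor Gx              ≡⟨ xor-same Gx ⟩
    false                  ∎
    where Gx = xorSum (map (G x) xs)

delete-imgSet : ∀ σ {w x} → Incr w → x ∈ w → delete (app σ x) (imgSet σ w) ≡ imgSet σ (delete x w)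
delete-imgSet σ {w} {x} p x∈ = incr-ext (delete-incr _ (imgSet-incr σ p)) (imgSet-incr σ (delete-incr x p)) to from
  where
  to : ∀ z → z ∈ delete (app σ x) (imgSet σ w) → z ∈ imgSet σ (delete x w)
  to z z∈ with ∈-delete⁻ z∈
  ... | z∈′ , z≢ with imgSet-∈⁻ σ {w} z∈′
  ... | x′ , x′∈ , refl = imgSet-∈⁺ σ {delete x w} (∈-delete⁺ x′∈ (λ e → z≢ (cong (app σ) e)))
  from : ∀ z → z ∈ imgSet σ (delete x w) → z ∈ delete (app σ x) (imgSet σ w)
  from z z∈ with imgSet-∈⁻ σ {delete x w} z∈
  ... | x′ , x′∈ , refl with ∈-delete⁻ x′∈
  ... | x′∈w , x′≢ = ∈-delete⁺ (imgSet-∈⁺ σ {w} x′∈w) (λ e → x′≢ (app-injective σ e))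

betaStar-imgSet : ∀ σ f {w} → Incr w → betaStar f (imgSet σ w) ≡ betaStar (λ u → f (imgSet σ u)) w
betaStar-imgSet σ f {w} p = begin
  betaStar f (imgSet σ w)                           ≡⟨ betaStar-delete f (imgSet-incr σ p) ⟩
  xorSum (map F (imgSet σ w))                       ≡⟨ xorSum-↭ (Perm.map⁺ F (imgSet-↭ σ w)) ⟩
  xorSum (map F (map (app σ) w))                    ≡⟨ cong xorSum (sym (List.map-∘ w)) ⟩
  xorSum (map (F ∘ app σ) w)                        ≡⟨ cong xorSum (map-cong∈ w (λ x x∈ → cong f (delete-imgSet σ p x∈))) ⟩
  xorSum (map (λ x → f (imgSet σ (delete x w))) w)  ≡⟨ sym (betaStar-delete (λ u → f (imgSet σ u)) p) ⟩
  betaStar (λ u → f (imgSet σ u)) w                 ∎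
  where
  open ≡-Reasoning
  F : ℕ → Bool
  F y = f (delete y (imgSet σ w))

opaque
  insert : ℕ → List ℕ → List ℕ
  insert x u = sortℕ (x ∷ u)

  insert-incr : ∀ {x u} → Incr u → x ∉ u → Incr (insert x u)
  insert-incr {x} {u} p x∉ = sort-incr (All.tabulate (λ {z} z∈ x≡z → x∉ (subst (_∈ u) (sym x≡z) z∈)) ∷ incr⇒unique p)

  insert-↭ : ∀ x u → insert x u ↭ x ∷ u
  insert-↭ x u = SortP.sort-↭ (x ∷ u)

  ∈-insert⁻ : ∀ {x u z} → z ∈ insert x u → z ≡ x ⊎ z ∈ u
  ∈-insert⁻ {x} {u} z∈ with ∈-sort⁻ {x ∷ u} z∈
  ... | here z≡x  = inj₁ z≡x
  ... | there z∈u = inj₂ z∈u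

  ∈-insert⁺ˡ : ∀ {x u} → x ∈ insert x u
  ∈-insert⁺ˡ {x} {u} = ∈-sort⁺ {x ∷ u} (here refl)

  ∈-insert⁺ʳ : ∀ {x u z} → z ∈ u → z ∈ insert x u
  ∈-insert⁺ʳ {x} {u} z∈ = ∈-sort⁺ {x ∷ u} (there z∈)

insert-length : ∀ x u → length (insert x u) ≡ suc (length u)
insert-length x u = Perm.↭-length (insert-↭ x u)

insert-delete : ∀ {x u} → Incr u → x ∈ u → insert x (delete x u) ≡ u
insert-delete {x} {u} p x∈ = incr-ext (insert-incr (delete-incr x p) (λ x∈′ → proj₂ (∈-delete⁻ x∈′) refl)) p to from
  where
  to : ∀ z → z ∈ insert x (delete x u) → z ∈ u
  to z z∈ = [ (λ { refl → x∈ }) , proj₁ ∘ ∈-delete⁻ ] (∈-insert⁻ z∈)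
  from : ∀ z → z ∈ u → z ∈ insert x (delete x u)
  from z z∈ with z ≟ x
  ... | yes refl = ∈-insert⁺ˡ
  ... | no z≢x   = ∈-insert⁺ʳ (∈-delete⁺ z∈ z≢x)

delete-insert : ∀ {x u} → Incr u → x ∉ u → delete x (insert x u) ≡ u
delete-insert {x} {u} p x∉ = incr-ext (delete-incr x (insert-incr p x∉)) p to from
  where
  to : ∀ z → z ∈ delete x (insert x u) → z ∈ u
  to z z∈ with ∈-delete⁻ z∈
  ... | z∈′ , z≢x = [ (λ z≡x → ⊥-elim (z≢x z≡x)) , id ] (∈-insert⁻ z∈′)
  from : ∀ z → z ∈ u → z ∈ delete x (insert x u)
  from z z∈ = ∈-delete⁺ (∈-insert⁺ʳ z∈) (λ { refl → x∉ z∈ })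

delete-insert-comm : ∀ {x y u} → Incr u → x ∉ u → y ≢ x → delete y (insert x u) ≡ insert x (delete y u)
delete-insert-comm {x} {y} {u} p x∉ y≢x =
  incr-ext (delete-incr y (insert-incr p x∉)) (insert-incr (delete-incr y p) (x∉ ∘ proj₁ ∘ ∈-delete⁻)) to from
  where
  to : ∀ z → z ∈ delete y (insert x u) → z ∈ insert x (delete y u)
  to z z∈ with ∈-delete⁻ z∈
  ... | z∈′ , z≢y with ∈-insert⁻ z∈′
  ...   | inj₁ refl = ∈-insert⁺ˡ
  ...   | inj₂ z∈u  = ∈-insert⁺ʳ (∈-delete⁺ z∈u z≢y)
  from : ∀ z → z ∈ insert x (delete y u) → z ∈ delete y (insert x u)
  from z z∈ with ∈-insert⁻ z∈
  ... | inj₁ refl = ∈-delete⁺ ∈-insert⁺ˡ (y≢x ∘ sym)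
  ... | inj₂ z∈′  = ∈-delete⁺ (∈-insert⁺ʳ (proj₁ (∈-delete⁻ z∈′))) (proj₂ (∈-delete⁻ z∈′))

-- The group G = Im β* ⋊ Sym(Ω) acting on M_n

idPerm : Perm
idPerm = mk↔ₛ′ id id (λ _ → refl) (λ _ → refl)

infixl 7 _⨾_ _·_

_⨾_ : Perm → Perm → Perm
σ ⨾ τ = mk↔ₛ′ (app τ ∘ app σ) (app⁻¹ σ ∘ app⁻¹ τ)
  (λ y → trans (cong (app τ) (app-app⁻¹ σ (app⁻¹ τ y))) (app-app⁻¹ τ y))
  (λ x → trans (cong (app⁻¹ σ) (app⁻¹-app τ (app σ x))) (app⁻¹-app σ x))

invPerm : Perm → Perm
invPerm σ = mk↔ₛ′ (app⁻¹ σ) (app σ) (app⁻¹-app σ) (app-app⁻¹ σ)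

ε : Elt
ε = mkElt (λ _ → false) idPerm

-- g · h acts as g followed by h, matching the right action m ↦ m^g.
_·_ : Elt → Elt → Elt
g · h = mkElt (λ u → fn g u xor fn h (imgSet (perm g) u)) (perm g ⨾ perm h)

_⁻¹ : Elt → Elt
g ⁻¹ = mkElt (λ u → fn g (imgSet (invPerm (perm g)) u)) (invPerm (perm g))

imgSet-⨾ : ∀ σ τ {w} → Incr w → imgSet (σ ⨾ τ) w ≡ imgSet τ (imgSet σ w)
imgSet-⨾ σ τ {w} p = incr-ext (imgSet-incr (σ ⨾ τ) p) (imgSet-incr τ (imgSet-incr σ p)) to from
  where
  to : ∀ z → z ∈ imgSet (σ ⨾ τ) w → z ∈ imgSet τ (imgSet σ w)
  to z z∈ with imgSet-∈⁻ (σ ⨾ τ) {w} z∈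
  ... | x , x∈ , refl = imgSet-∈⁺ τ (imgSet-∈⁺ σ x∈)
  from : ∀ z → z ∈ imgSet τ (imgSet σ w) → z ∈ imgSet (σ ⨾ τ) w
  from z z∈ with imgSet-∈⁻ τ {imgSet σ w} z∈
  ... | y , y∈ , refl with imgSet-∈⁻ σ {w} y∈
  ... | x , x∈ , refl = imgSet-∈⁺ (σ ⨾ τ) x∈

imgSet-invPerm-imgSet : ∀ σ {w} → Incr w → imgSet (invPerm σ) (imgSet σ w) ≡ w
imgSet-invPerm-imgSet σ p =
  trans (sym (imgSet-⨾ σ (invPerm σ) p)) (imgSet-fixed (σ ⨾ invPerm σ) p (λ x _ → app⁻¹-app σ x))

imgSet-imgSet-invPerm : ∀ σ {w} → Incr w → imgSet σ (imgSet (invPerm σ) w) ≡ w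
imgSet-imgSet-invPerm σ p =
  trans (sym (imgSet-⨾ (invPerm σ) σ p)) (imgSet-fixed (invPerm σ ⨾ σ) p (λ x _ → app-app⁻¹ σ x))

act-valid : ∀ n g m → Valid n m → Valid n (act g m)
act-valid n g (pt x)     v       = tt
act-valid n g (nset w)   (p , l) = imgSet-incr (perm g) p , trans (imgSet-length (perm g) w) l
act-valid n g (pair w b) (p , l) = imgSet-incr (perm g) p , trans (imgSet-length (perm g) w) l

act-ε : ∀ n m → Valid n m → act ε m ≡ m
act-ε n (pt x)     v       = refl
act-ε n (nset w)   (p , _) = cong nset (imgSet-fixed idPerm p (λ _ _ → refl))
act-ε n (pair w b) (p , _) =
  cong₂ pair (imgSet-fixed idPerm p (λ _ _ → refl)) (trans (cong (b xor_) (betaStar-zero w)) (xor-identityʳ b))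

act-· : ∀ n g h m → Valid n m → act (g · h) m ≡ act h (act g m)
act-· n g h (pt x)     v       = refl
act-· n g h (nset w)   (p , _) = cong nset (imgSet-⨾ (perm g) (perm h) p)
act-· n g h (pair w b) (p , _) = cong₂ pair (imgSet-⨾ (perm g) (perm h) p) (begin
  b xor betaStar (λ u → fn g u xor fn h (imgSet (perm g) u)) w
    ≡⟨ cong (b xor_) (betaStar-xor (fn g) _ w) ⟩
  b xor (betaStar (fn g) w xor betaStar (λ u → fn h (imgSet (perm g) u)) w)
    ≡⟨ cong (λ c → b xor (betaStar (fn g) w xor c)) (sym (betaStar-imgSet (perm g) (fn h) p)) ⟩
  b xor (betaStar (fn g) w xor betaStar (fn h) (imgSet (perm g) w))
    ≡⟨ sym (xor-assoc b _ _) ⟩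
  (b xor betaStar (fn g) w) xor betaStar (fn h) (imgSet (perm g) w)   ∎)
  where open ≡-Reasoning

xor-cancelʳ : ∀ b c d → c ≡ d → (b xor c) xor d ≡ b
xor-cancelʳ b c _ refl = trans (xor-assoc b c c) (trans (cong (b xor_) (xor-same c)) (xor-identityʳ b))

act-⁻¹-act : ∀ n g m → Valid n m → act (g ⁻¹) (act g m) ≡ m
act-⁻¹-act n g (pt x)     v       = cong pt (app⁻¹-app (perm g) x)
act-⁻¹-act n g (nset w)   (p , _) = cong nset (imgSet-invPerm-imgSet (perm g) p)
act-⁻¹-act n g (pair w b) (p , _) = cong₂ pair (imgSet-invPerm-imgSet (perm g) p) (xor-cancelʳ b _ _ (sym (begin
  betaStar (λ u → fn g (imgSet (invPerm (perm g)) u)) (imgSet (perm g) w)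
    ≡⟨ betaStar-imgSet (perm g) _ p ⟩
  betaStar (λ u → fn g (imgSet (invPerm (perm g)) (imgSet (perm g) u))) w
    ≡⟨ betaStar-cong _ _ w (λ u u∈ → cong (fn g) (imgSet-invPerm-imgSet (perm g) (removals-incr p u∈))) ⟩
  betaStar (fn g) w   ∎)))
  where open ≡-Reasoning

act-act-⁻¹ : ∀ n g m → Valid n m → act g (act (g ⁻¹) m) ≡ m
act-act-⁻¹ n g (pt x)     v       = cong pt (app-app⁻¹ (perm g) x)
act-act-⁻¹ n g (nset w)   (p , _) = cong nset (imgSet-imgSet-invPerm (perm g) p)
act-act-⁻¹ n g (pair w b) (p , _) = cong₂ pair (imgSet-imgSet-invPerm (perm g) p)
  (xor-cancelʳ b _ _ (sym (betaStar-imgSet (invPerm (perm g)) (fn g) p)))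

act-agree : ∀ {n} φ ψ σ τ m → Valid n m →
  (∀ z → z ∈ suppPt m → app σ z ≡ app τ z) →
  (∀ w → IsMSet n w → All (_∈ suppPt m) w → betaStar φ w ≡ betaStar ψ w) →
  act (mkElt φ σ) m ≡ act (mkElt ψ τ) m
act-agree φ ψ σ τ (pt x)     vm hp hb = cong pt (hp x (here refl))
act-agree φ ψ σ τ (nset w)   vm hp hb = cong nset (imgSet-cong σ τ (proj₁ vm) hp)
act-agree φ ψ σ τ (pair w b) vm hp hb =
  cong₂ pair (imgSet-cong σ τ (proj₁ vm) hp) (cong (b xor_) (hb w vm (All.tabulate id)))

-- The cone over a point s is a contracting homotopy for β*.

module Cone (f : Fn) (s : ℕ) where

  cone : Fn
  cone r = if does (s ∈? r) then false else f (insert s r)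

  cone-∋ : ∀ {r} → s ∈ r → cone r ≡ false
  cone-∋ {r} s∈ with s ∈? r
  ... | yes _  = refl
  ... | no s∉ = ⊥-elim (s∉ s∈)

  cone-∌ : ∀ {r} → s ∉ r → cone r ≡ f (insert s r)
  cone-∌ {r} s∉ with s ∈? r
  ... | yes s∈ = ⊥-elim (s∉ s∈)
  ... | no _   = refl

  betaStar-cone-∋ : ∀ {u} → Incr u → s ∈ u → betaStar cone u ≡ f u
  betaStar-cone-∋ {u} p s∈ = begin
    betaStar cone u                           ≡⟨ betaStar-delete cone p ⟩
    xorSum (map (λ y → cone (delete y u)) u)  ≡⟨ xorSum-single _ s p s∈ (λ y _ y≢s → cone-∋ (∈-delete⁺ s∈ (y≢s ∘ sym))) ⟩
    cone (delete s u)                         ≡⟨ cone-∌ (λ s∈′ → proj₂ (∈-delete⁻ s∈′) refl) ⟩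
    f (insert s (delete s u))                 ≡⟨ cong f (insert-delete p s∈) ⟩
    f u                                       ∎
    where open ≡-Reasoning

  betaStar-insert : ∀ {u} → Incr u → s ∉ u → betaStar f (insert s u) ≡ f u xor betaStar cone u
  betaStar-insert {u} p s∉ = begin
    betaStar f w                                      ≡⟨ betaStar-delete f w-incr ⟩
    xorSum (map F w)                                  ≡⟨ xorSum-↭ (Perm.map⁺ F (insert-↭ s u)) ⟩
    F s xor xorSum (map F u)                          ≡⟨ cong₂ _xor_ (cong f (delete-insert p s∉)) (cong xorSum (map-cong∈ u F≡cone)) ⟩
    f u xor xorSum (map (λ y → cone (delete y u)) u)  ≡⟨ cong (f u xor_) (sym (betaStar-delete cone p)) ⟩
    f u xor betaStar cone u                           ∎
    where
    open ≡-Reasoning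
    w = insert s u
    w-incr = insert-incr p s∉
    F : ℕ → Bool
    F y = f (delete y w)
    F≡cone : ∀ y → y ∈ u → F y ≡ cone (delete y u)
    F≡cone y y∈ = trans (cong f (delete-insert-comm p s∉ λ { refl → s∉ y∈ }))
                        (sym (cone-∌ (s∉ ∘ proj₁ ∘ ∈-delete⁻)))

-- If β*f vanishes on [S]^{m+2}, then f may be changed by an element of ker β*
-- (namely β*(cone f s) for some s ∈ S) so as to vanish on [S]^{m+1}.
vanishing-representative : ∀ m S f →
  (∀ w → IsMSet (suc (suc m)) w → All (_∈ S) w → betaStar f w ≡ false) →
  Σ Fn λ v → (∀ u → IsMSet (suc m) u → All (_∈ S) u → v u ≡ false)
           × (∀ w → Incr w → betaStar f w ≡ betaStar v w)
vanishing-representative m [] f _ = f , (λ { [] (_ , ()) _ ; (_ ∷ _) _ (() ∷ _) }) , λ _ _ → refl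
vanishing-representative m (s ∷ S) f f-vanishes = v , v-vanishes , λ w p → sym (same-beta p)
  where
  open Cone f s
  v : Fn
  v u = f u xor betaStar cone u
  v-vanishes : ∀ u → IsMSet (suc m) u → All (_∈ s ∷ S) u → v u ≡ false
  v-vanishes u (p , l) u⊆ with s ∈? u
  ... | yes s∈ = trans (cong (f u xor_) (betaStar-cone-∋ p s∈)) (xor-same (f u))
  ... | no s∉  = trans (sym (betaStar-insert p s∉))
    (f-vanishes (insert s u) (insert-incr p s∉ , trans (insert-length s u) (cong suc l))
      (All.tabulate λ z∈ → [ (λ { refl → here refl }) , All.lookup u⊆ ] (∈-insert⁻ z∈)))
  same-beta : ∀ {w} → Incr w → betaStar v w ≡ betaStar f w
  same-beta {w} p = begin
    betaStar v w                                 ≡⟨ betaStar-xor f (betaStar cone) w ⟩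
    betaStar f w xor betaStar (betaStar cone) w  ≡⟨ cong (betaStar f w xor_) (betaStar² cone p) ⟩
    betaStar f w xor false                       ≡⟨ xor-identityʳ _ ⟩
    betaStar f w                                 ∎
    where open ≡-Reasoning

-- Subsets of a finite set

sublists : {X : Set} → List X → List (List X)
sublists []       = [] ∷ []
sublists (x ∷ xs) = map (x ∷_) (sublists xs) ++ sublists xs

filter∈sublists : ∀ {X : Set} {P : X → Set} (P? : ∀ x → Dec (P x)) xs → filter P? xs ∈ sublists xs
filter∈sublists P? []       = here refl
filter∈sublists P? (x ∷ xs) with P? x
... | yes _ = ∈-++⁺ˡ (∈-map⁺ (x ∷_) (filter∈sublists P? xs))
... | no _  = ∈-++⁺ʳ (map (x ∷_) (sublists xs)) (filter∈sublists P? xs)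

∈-sublists⁻ : ∀ {s B} → Incr s → B ∈ sublists s → Incr B × All (_∈ s) B
∈-sublists⁻ {[]}     p (here refl) = [] , []
∈-sublists⁻ {x ∷ xs} p B∈ with ∈-++⁻ (map (x ∷_) (sublists xs)) B∈
... | inj₂ B∈′ = proj₁ IH , All.map there (proj₂ IH)
  where IH = ∈-sublists⁻ (Linked.tail p) B∈′
... | inj₁ B∈′ with ∈-map⁻ (x ∷_) B∈′
...   | B , B∈″ , refl with ∈-sublists⁻ (Linked.tail p) B∈″
...     | q , B⊆ = cons-incr B⊆ q , here refl ∷ All.map there B⊆
  where
  cons-incr : ∀ {B} → All (_∈ xs) B → Incr B → Incr (x ∷ B)
  cons-incr []          _ = [-]
  cons-incr (y∈ ∷ _)    q = incr-head< p y∈ ∷ q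

∈-∷-tail : ∀ {x xs} {b : List ℕ} → All (_∈ x ∷ xs) b → All (x <_) b → All (_∈ xs) b
∈-∷-tail []                 []            = []
∈-∷-tail (here refl ∷ b⊆)   (x<x ∷ _)     = ⊥-elim (<-irrefl refl x<x)
∈-∷-tail (there y∈ ∷ b⊆)    (_ ∷ x<b)     = y∈ ∷ ∈-∷-tail b⊆ x<b

count₂ : List ℕ → List (List ℕ) → Bool
count₂ b Bs = xorSum (map (λ B → does (b ≟ₗ B)) Bs)

count₂-absent : ∀ b Bs → (∀ B → B ∈ Bs → b ≢ B) → count₂ b Bs ≡ false
count₂-absent b Bs h = xorSum-false _ Bs (All.tabulate λ B∈ → dec-false (b ≟ₗ _) (h _ B∈))

count₂-++ : ∀ b Bs Cs → count₂ b (Bs ++ Cs) ≡ count₂ b Bs xor count₂ b Cs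
count₂-++ b Bs Cs = trans (cong xorSum (List.map-++ _ Bs Cs)) (xorSum-++ (map (λ B → does (b ≟ₗ B)) Bs) _)

count₂-map-∷ : ∀ x b Bs → count₂ (x ∷ b) (map (x ∷_) Bs) ≡ count₂ b Bs
count₂-map-∷ x b Bs = cong xorSum (trans (sym (List.map-∘ Bs)) (List.map-cong does-∷ Bs))
  where
  does-∷ : ∀ B → does ((x ∷ b) ≟ₗ (x ∷ B)) ≡ does (b ≟ₗ B)
  does-∷ B = cong (_∧ does (b ≟ₗ B)) (dec-true (x ≟ x) refl)

count₂-sublists : ∀ {s b} → Incr s → Incr b → All (_∈ s) b → count₂ b (sublists s) ≡ true
count₂-sublists {[]}     {[]}    p q b⊆       = refl
count₂-sublists {[]}     {_ ∷ _} p q (() ∷ _)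
count₂-sublists {x ∷ xs} {b}     p q b⊆ = begin
  count₂ b (map (x ∷_) (sublists xs) ++ sublists xs)
    ≡⟨ count₂-++ b (map (x ∷_) (sublists xs)) (sublists xs) ⟩
  count₂ b (map (x ∷_) (sublists xs)) xor count₂ b (sublists xs)
    ≡⟨ split b q b⊆ ⟩
  true ∎
  where
  open ≡-Reasoning
  all-in-xs : ∀ {B} → B ∈ sublists xs → All (_∈ xs) B
  all-in-xs B∈ = proj₂ (∈-sublists⁻ (Linked.tail p) B∈)
  split : ∀ b → Incr b → All (_∈ x ∷ xs) b →
    count₂ b (map (x ∷_) (sublists xs)) xor count₂ b (sublists xs) ≡ true
  split [] q _ = trans
    (cong (_xor count₂ [] (sublists xs)) (count₂-absent [] (map (x ∷_) (sublists xs)) λ B B∈ →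
      case ∈-map⁻ (x ∷_) B∈ of λ { (_ , _ , refl) () }))
    (count₂-sublists (Linked.tail p) q [])
  split (y ∷ b) q (y∈ ∷ b⊆) with y ≟ x
  ... | yes refl = trans
    (cong₂ _xor_ (trans (count₂-map-∷ y b (sublists xs))
                        (count₂-sublists (Linked.tail p) (Linked.tail q) (∈-∷-tail b⊆ (All.tabulate (incr-head< q)))))
                 (count₂-absent (y ∷ b) (sublists xs) λ { B B∈ refl → incr-head∉ p (All.lookup (all-in-xs B∈) (here refl)) }))
    refl
  ... | no y≢x = cong₂ _xor_
    (count₂-absent (y ∷ b) (map (x ∷_) (sublists xs)) λ B B∈ →
      case ∈-map⁻ (x ∷_) B∈ of λ { (_ , _ , refl) → y≢x ∘ List.∷-injectiveˡ })
    (count₂-sublists (Linked.tail p) q (∈-∷-tail (y∈ ∷ b⊆) (x<y ∷ All.tabulate (λ z∈ → <-trans x<y (incr-head< q z∈)))))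
    where
    x<y : x < y
    x<y = incr-head< p (case y∈ of λ { (here y≡x) → ⊥-elim (y≢x y≡x) ; (there y∈xs) → y∈xs })

∈-sublists⁺ : ∀ {s b} → Incr s → Incr b → All (_∈ s) b → b ∈ sublists s
∈-sublists⁺ {s} {b} p q b⊆ with b ∈ₗ? sublists s
... | yes b∈ = b∈
... | no b∉  = case trans (sym (count₂-sublists p q b⊆)) (count₂-absent b (sublists s) λ { B B∈ refl → b∉ B∈ }) of λ ()

xorSum-∧ʳ : ∀ {A : Set} (g : A → Bool) c xs → xorSum (map (λ x → g x ∧ c) xs) ≡ xorSum (map g xs) ∧ c
xorSum-∧ʳ g c []       = refl
xorSum-∧ʳ g c (x ∷ xs) = trans (cong ((g x ∧ c) xor_) (xorSum-∧ʳ g c xs)) (sym (∧-distribʳ-xor c (g x) _))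

xorSum-filter : ∀ {A : Set} {P : A → Set} (P? : ∀ x → Dec (P x)) (g : A → Bool) xs →
  (∀ x → x ∈ xs → ¬ P x → g x ≡ false) → xorSum (map g (filter P? xs)) ≡ xorSum (map g xs)
xorSum-filter P? g []       h = refl
xorSum-filter P? g (x ∷ xs) h with P? x
... | yes _  = cong (g x xor_) (xorSum-filter P? g xs (λ y y∈ → h y (there y∈)))
... | no ¬Px = trans (xorSum-filter P? g xs (λ y y∈ → h y (there y∈))) (cong (_xor xorSum (map g xs)) (sym (h x (here refl) ¬Px)))

max : List ℕ → ℕ
max = foldr _⊔_ 0

∈⇒≤max : ∀ {x l} → x ∈ l → x ≤ max l
∈⇒≤max {x} {y ∷ l} (here refl) = m≤m⊔n x (max l)
∈⇒≤max {x} {y ∷ l} (there x∈)  = ≤-trans (∈⇒≤max x∈) (m≤n⊔m y (max l))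

enumerate : List ℕ → List ℕ
enumerate S = filter (_∈? S) (upTo (suc (max S)))

enumerate-incr : ∀ S → Incr (enumerate S)
enumerate-incr S = Linked.filter⁺ (_∈? S) <-trans (Linked.applyUpTo⁺₁ id _ (λ _ → n<1+n _))

∈-enumerate⁺ : ∀ {S x} → x ∈ S → x ∈ enumerate S
∈-enumerate⁺ {S} x∈ = ∈-filter⁺ (_∈? S) (∈-upTo⁺ (s≤s (∈⇒≤max x∈))) x∈

∈-enumerate⁻ : ∀ {S x} → x ∈ enumerate S → x ∈ S
∈-enumerate⁻ {S} x∈ = proj₂ (∈-filter⁻ (_∈? S) x∈)

-- A function on [Ω]^m vanishing on [S]^m lies in V_S: split it according to the traces w ∩ S.
module Decomposition (m : ℕ) (S : List ℕ) (v : Fn)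
  (v-vanishes : ∀ u → IsMSet m u → All (_∈ S) u → v u ≡ false) where

  trace : List ℕ → List ℕ
  trace u = filter (_∈? S) u

  traces : List (List ℕ)
  traces = filter (λ B → length B <? m) (sublists (enumerate S))

  part : List ℕ → Fn
  part B u = does (trace u ≟ₗ B) ∧ v u

  components : List (List ℕ × Fn)
  components = map (λ B → B , part B) traces

  decomposed : Fn
  decomposed u = xorSum (map (λ c → proj₂ c u) components)

  trace-short : ∀ {u} → IsMSet m u → v u ≡ true → length (trace u) < m
  trace-short {u} (p , l) vu with all? (_∈? S) u
  ... | yes u⊆S = case trans (sym vu) (v-vanishes u (p , l) u⊆S) of λ ()
  ... | no u⊈S  = <-≤-trans (List.filter-notAll (_∈? S) u (All.¬All⇒Any¬ (_∈? S) u u⊈S)) (≤-reflexive l)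

  decomposed≡v : ∀ u → IsMSet m u → decomposed u ≡ v u
  decomposed≡v u mu = begin
    xorSum (map (λ c → proj₂ c u) components)  ≡⟨ cong xorSum (sym (List.map-∘ traces)) ⟩
    xorSum (map (λ B → part B u) traces)       ≡⟨ xorSum-∧ʳ (λ B → does (trace u ≟ₗ B)) (v u) traces ⟩
    count₂ (trace u) traces ∧ v u              ≡⟨ count₂∧v (v u) refl ⟩
    v u                                        ∎
    where
    open ≡-Reasoning
    count₂∧v : ∀ c → v u ≡ c → count₂ (trace u) traces ∧ c ≡ c
    count₂∧v false _  = ∧-zeroʳ _
    count₂∧v true  vu = begin
      count₂ (trace u) traces ∧ true                 ≡⟨ ∧-identityʳ _ ⟩
      count₂ (trace u) traces
        ≡⟨ xorSum-filter (λ B → length B <? m) _ (sublists (enumerate S))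
             (λ B _ B≮m → dec-false (trace u ≟ₗ B) λ { refl → B≮m (trace-short mu vu) }) ⟩
      count₂ (trace u) (sublists (enumerate S))
        ≡⟨ count₂-sublists (enumerate-incr S) (Linked.filter⁺ (_∈? S) <-trans (proj₁ mu))
             (All.tabulate λ z∈ → ∈-enumerate⁺ (proj₂ (∈-filter⁻ (_∈? S) {xs = u} z∈))) ⟩
      true                                           ∎

  part∈V : ∀ B → V m B S (part B)
  part∈V B w _ w∩S≢B with trace w ≟ₗ B
  ... | yes refl = ⊥-elim (w∩S≢B λ x → (λ (x∈w , x∈S) → ∈-filter⁺ (_∈? S) x∈w x∈S) , ∈-filter⁻ (_∈? S) {xs = w})
  ... | no _     = refl

  decomposed∈VS : VS m S decomposed
  decomposed∈VS = components , All.map⁺ (All.tabulate component-ok) , λ _ → refl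
    where
    component-ok : ∀ {B} → B ∈ traces → Incr B × All (_∈ S) B × length B < m × V m B S (part B)
    component-ok {B} B∈ with ∈-filter⁻ (λ B → length B <? m) {xs = sublists (enumerate S)} B∈
    ... | B∈′ , B<m with ∈-sublists⁻ (enumerate-incr S) B∈′
    ...   | B-incr , B⊆ = B-incr , All.map ∈-enumerate⁻ B⊆ , B<m , part∈V B

VS⇒vanishing : ∀ m S v → VS m S v → ∀ u → IsMSet m u → All (_∈ S) u → v u ≡ false
VS⇒vanishing m S v (comps , comps-ok , v≡) u (p , l) u⊆S =
  trans (v≡ u) (xorSum-false _ comps (All.map (λ { {_ , φ} → vanishes φ }) comps-ok))
  where
  vanishes : ∀ {B} φ → Incr B × All (_∈ S) B × length B < m × V m B S φ → φ u ≡ false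
  vanishes φ (B-incr , _ , B<m , φ∈V) = φ∈V u (p , l) λ u∩S≡B →
    <-irrefl (trans (cong length (sym (incr-ext p B-incr (λ z z∈ → proj₁ (u∩S≡B z) (z∈ , All.lookup u⊆S z∈))
                                                          (λ z z∈ → proj₁ (proj₂ (u∩S≡B z) z∈))))) l) B<m

betaStar-vanishing⇒∈WS : ∀ k S f → (∀ w → IsMSet (suc (suc k)) w → All (_∈ S) w → betaStar f w ≡ false) →
  Σ Fn λ v → VS (suc k) S v × (∀ w → IsMSet (suc (suc k)) w → betaStar f w ≡ betaStar v w)
betaStar-vanishing⇒∈WS k S f β-vanishes with vanishing-representative k S f β-vanishes
... | v , v-vanishes , β≡βv = decomposed , decomposed∈VS , λ w mw →
  trans (β≡βv w (proj₁ mw)) (betaStar-cong v decomposed w λ u u∈ → sym (decomposed≡v u (removals-mset mw u∈)))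
  where open Decomposition (suc k) S v v-vanishes

∈WS⇒betaStar-vanishing : ∀ m S f v → VS m S v → (∀ w → IsMSet (suc m) w → betaStar f w ≡ betaStar v w) →
  ∀ w → IsMSet (suc m) w → All (_∈ S) w → betaStar f w ≡ false
∈WS⇒betaStar-vanishing m S f v v∈VS β≡βv w mw w⊆ = trans (β≡βv w mw) (xorSum-false v (removals w) (All.tabulate λ u∈ →
  VS⇒vanishing m S v v∈VS _ (removals-mset mw u∈) (All.tabulate λ z∈ → All.lookup w⊆ (removals-⊆ (proj₁ mw) u∈ z∈))))

-- The pointwise stabiliser of cl(A)

pt-injective : ∀ {x y} → pt x ≡ pt y → x ≡ y
pt-injective refl = refl

nset-injective : ∀ {w w′} → nset w ≡ nset w′ → w ≡ w′
nset-injective refl = refl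

pair-injective : ∀ {w w′ b b′} → pair w b ≡ pair w′ b′ → w ≡ w′ × b ≡ b′
pair-injective refl = refl , refl

∈-supp⁺ : ∀ {A a z} → a ∈ A → z ∈ suppPt a → z ∈ supp A
∈-supp⁺ {a ∷ A} (here refl) z∈ = ∈-++⁺ˡ z∈
∈-supp⁺ {b ∷ A} (there a∈)  z∈ = ∈-++⁺ʳ (suppPt b) (∈-supp⁺ a∈ z∈)

∈-supp⁻ : ∀ {A z} → z ∈ supp A → ∃ λ a → a ∈ A × z ∈ suppPt a
∈-supp⁻ {a ∷ A} z∈ with ∈-++⁻ (suppPt a) z∈
... | inj₁ z∈a = a , here refl , z∈a
... | inj₂ z∈A with ∈-supp⁻ {A} z∈A
...   | b , b∈ , z∈b = b , there b∈ , z∈b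

A⊆cl : ∀ {A a} → a ∈ A → cl A a
A⊆cl {a = pt x}     a∈ = ∈-supp⁺ a∈ (here refl)
A⊆cl {a = nset w}   a∈ = All.tabulate (∈-supp⁺ a∈)
A⊆cl {a = pair w b} a∈ = All.tabulate (∈-supp⁺ a∈)

FixesClOf : ℕ → List ℕ → Elt → Set
FixesClOf n S e = (∀ x → x ∈ S → app (perm e) x ≡ x)
                × (∀ w → IsMSet n w → All (_∈ S) w → betaStar (fn e) w ≡ false)

Fixes-cl⇔FixesClOf : ∀ n A e → Fixes n (cl A) e ⇔ FixesClOf n (supp A) e
Fixes-cl⇔FixesClOf n A e = mk⇔ to from
  where
  to : Fixes n (cl A) e → FixesClOf n (supp A) e
  to fixes = (λ x x∈ → pt-injective (fixes (pt x) tt x∈))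
           , (λ w mw w⊆ → proj₂ (pair-injective (fixes (pair w false) mw w⊆)))
  from : FixesClOf n (supp A) e → Fixes n (cl A) e
  from (σ-fixes , β-vanishes) (pt x)     _  x∈ = cong pt (σ-fixes x x∈)
  from (σ-fixes , β-vanishes) (nset w)   mw w⊆ =
    cong nset (imgSet-fixed (perm e) (proj₁ mw) (λ x x∈ → σ-fixes x (All.lookup w⊆ x∈)))
  from (σ-fixes , β-vanishes) (pair w b) mw w⊆ = cong₂ pair
    (imgSet-fixed (perm e) (proj₁ mw) (λ x x∈ → σ-fixes x (All.lookup w⊆ x∈)))
    (trans (cong (b xor_) (β-vanishes w mw w⊆)) (xor-identityʳ b))

Fixes-cl⇔WS⋊Sym : ∀ k A e → Fixes (suc (suc k)) (cl A) e ⇔ InWSSym (suc k) (supp A) e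
Fixes-cl⇔WS⋊Sym k A e = mk⇔
  (λ fixes → let σ-fixes , β-vanishes = Equivalence.to (Fixes-cl⇔FixesClOf _ A e) fixes
             in σ-fixes , betaStar-vanishing⇒∈WS k (supp A) (fn e) β-vanishes)
  (λ (σ-fixes , v , v∈VS , β≡βv) → Equivalence.from (Fixes-cl⇔FixesClOf _ A e)
     (σ-fixes , ∈WS⇒betaStar-vanishing (suc k) (supp A) (fn e) v v∈VS β≡βv))

Fixes-ε : ∀ n X → Fixes n X ε
Fixes-ε n X m vm _ = act-ε n m vm

Fixes-· : ∀ n X g h → Fixes n X g → Fixes n X h → Fixes n X (g · h)
Fixes-· n X g h g-fixes h-fixes m vm x = trans (act-· n g h m vm) (trans (cong (act h) (g-fixes m vm x)) (h-fixes m vm x))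

Fixes-subgroup : ∀ n (X Y : Pt → Set) → (∀ m → Valid n m → Y m → X m) → IsSubgroupOf n (Fixes n X) (Fixes n Y)
Fixes-subgroup n X Y Y⊆X = record
  { sub    = λ g fixes m vm y → fixes m vm (Y⊆X m vm y)
  ; resp   = λ g h fixes same m vm x → trans (sym (same m vm)) (fixes m vm x)
  ; hasId  = ε , Fixes-ε n X , act-ε n
  ; hasMul = λ g h g-fixes h-fixes → g · h , Fixes-· n X g h g-fixes h-fixes , act-· n g h
  ; hasInv = λ g g-fixes → g ⁻¹
           , (λ m vm x → trans (cong (act (g ⁻¹)) (sym (g-fixes m vm x))) (act-⁻¹-act n g m vm))
           , act-⁻¹-act n g
  }

Fixes-closed : ∀ n X → IsClosed n (Fixes n X)
Fixes-closed n X g approx m vm x with approx (m ∷ []) (vm ∷ [])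
... | h , h-fixes , (h≡g ∷ []) = trans (sym h≡g) (h-fixes m vm x)

act-fixed⇒suppPt-closed : ∀ g a → act g a ≡ a → ∀ {x} → x ∈ suppPt a → app (perm g) x ∈ suppPt a
act-fixed⇒suppPt-closed g (pt y)     ga≡a (here refl) = here (pt-injective ga≡a)
act-fixed⇒suppPt-closed g (nset w)   ga≡a x∈ = subst (_ ∈_) (nset-injective ga≡a) (imgSet-∈⁺ (perm g) x∈)
act-fixed⇒suppPt-closed g (pair w b) ga≡a x∈ = subst (_ ∈_) (proj₁ (pair-injective ga≡a)) (imgSet-∈⁺ (perm g) x∈)

Fixes-A-preserves-supp : ∀ {n A} → All (Valid n) A → ∀ g → Fixes n (InList A) g → ∀ x → x ∈ supp A → app (perm g) x ∈ supp A
Fixes-A-preserves-supp {A = A} vA g g-fixes x x∈ with ∈-supp⁻ {A} x∈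
... | a , a∈ , x∈a = ∈-supp⁺ a∈ (act-fixed⇒suppPt-closed g a (g-fixes a (All.lookup vA a∈) a∈) x∈a)

-- Finite index

opaque
  swapℕ : ℕ → ℕ → ℕ → ℕ
  swapℕ a b z with z ≟ a
  ... | yes _ = b
  ... | no _ with z ≟ b
  ...   | yes _ = a
  ...   | no _  = z

  swapℕ-a : ∀ a b → swapℕ a b a ≡ b
  swapℕ-a a b with a ≟ a
  ... | yes _  = refl
  ... | no a≢a = ⊥-elim (a≢a refl)

  swapℕ-b : ∀ a b → swapℕ a b b ≡ a
  swapℕ-b a b with b ≟ a
  ... | yes refl = refl
  ... | no _ with b ≟ b
  ...   | yes _  = refl
  ...   | no b≢b = ⊥-elim (b≢b refl)

  swapℕ-other : ∀ a b z → z ≢ a → z ≢ b → swapℕ a b z ≡ z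
  swapℕ-other a b z z≢a z≢b with z ≟ a
  ... | yes z≡a = ⊥-elim (z≢a z≡a)
  ... | no _ with z ≟ b
  ...   | yes z≡b = ⊥-elim (z≢b z≡b)
  ...   | no _    = refl

swapℕ-cases : ∀ {T : ℕ → Set} a b z → (z ≡ a → T b) → (z ≡ b → T a) → (z ≢ a → z ≢ b → T z) → T (swapℕ a b z)
swapℕ-cases {T} a b z at-a at-b elsewhere with z ≟ a | z ≟ b
... | yes refl | _        = subst T (sym (swapℕ-a z b)) (at-a refl)
... | no _     | yes refl = subst T (sym (swapℕ-b a z)) (at-b refl)
... | no z≢a   | no z≢b   = subst T (sym (swapℕ-other a b z z≢a z≢b)) (elsewhere z≢a z≢b)

swapℕ-involutive : ∀ a b z → swapℕ a b (swapℕ a b z) ≡ z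
swapℕ-involutive a b z = swapℕ-cases {λ y → swapℕ a b y ≡ z} a b z
  (λ { refl → swapℕ-b z b }) (λ { refl → swapℕ-a a z }) (swapℕ-other a b z)

swapℕ-same : ∀ a z → swapℕ a a z ≡ z
swapℕ-same a z = swapℕ-cases {_≡ z} a a z sym sym (λ _ _ → refl)

swapℕ-preserves : ∀ {T : ℕ → Set} a b z → T a → T b → T z → T (swapℕ a b z)
swapℕ-preserves {T} a b z ta tb tz = swapℕ-cases {T} a b z (λ _ → tb) (λ _ → ta) (λ _ _ → tz)

transposition : ℕ → ℕ → Perm
transposition a b = mk↔ₛ′ (swapℕ a b) (swapℕ a b) (swapℕ-involutive a b) (swapℕ-involutive a b)

-- The product τ_{aₖ bₖ} ∘ ⋯ ∘ τ_{a₁ b₁} of the transpositions in the list (aₖ , bₖ) ∷ ⋯.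
transpositions : List (ℕ × ℕ) → Perm
transpositions []             = idPerm
transpositions ((a , b) ∷ ps) = transpositions ps ⨾ transposition a b

transpositions-preserves : ∀ {T : ℕ → Set} ps → All (λ (a , b) → T a × T b) ps →
  ∀ z → T z → T (app (transpositions ps) z)
transpositions-preserves []             []               z tz = tz
transpositions-preserves ((a , b) ∷ ps) ((ta , tb) ∷ ts) z tz = swapℕ-preserves a b _ ta tb (transpositions-preserves ps ts z tz)

transpositions⁻¹-preserves : ∀ {T : ℕ → Set} ps → All (λ (a , b) → T a × T b) ps →
  ∀ z → T z → T (app⁻¹ (transpositions ps) z)
transpositions⁻¹-preserves []             []               z tz = tz
transpositions⁻¹-preserves ((a , b) ∷ ps) ((ta , tb) ∷ ts) z tz = transpositions⁻¹-preserves ps ts _ (swapℕ-preserves a b z ta tb tz)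

matching : (ℕ → ℕ) → List ℕ → List (ℕ × ℕ)
matching σ []      = []
matching σ (x ∷ L) = (app (transpositions (matching σ L)) x , σ x) ∷ matching σ L

length-matching : ∀ σ L → length (matching σ L) ≡ length L
length-matching σ []      = refl
length-matching σ (x ∷ L) = cong suc (length-matching σ L)

matching-agrees : ∀ (σ : ℕ → ℕ) → (∀ {x y} → σ x ≡ σ y → x ≡ y) → ∀ {L} → Unique L →
  ∀ z → z ∈ L → app (transpositions (matching σ L)) z ≡ σ z
matching-agrees σ σ-inj {x ∷ L} (_ ∷ _) z (here refl) = swapℕ-a (app (transpositions (matching σ L)) x) (σ x)
matching-agrees σ σ-inj {x ∷ L} (x∉L ∷ L-unique) z (there z∈) = trans
  (cong (swapℕ (app ρ x) (σ x)) IH)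
  (swapℕ-other _ _ (σ z) (λ e → All.lookup x∉L z∈ (sym (app-injective ρ (trans IH e))))
                         (λ e → All.lookup x∉L z∈ (sym (σ-inj e))))
  where
  ρ = transpositions (matching σ L)
  IH = matching-agrees σ σ-inj L-unique z z∈

matching-all : ∀ (Q : ℕ × ℕ → Set) σ L →
  (∀ ps → All Q ps → ∀ x → x ∈ L → Q (app (transpositions ps) x , σ x)) → All Q (matching σ L)
matching-all Q σ []      h = []
matching-all Q σ (x ∷ L) h = h (matching σ L) rest x (here refl) ∷ rest
  where rest = matching-all Q σ L (λ ps qs y y∈ → h ps qs y (there y∈))

tuples : {X : Set} → List X → ℕ → List (List X)
tuples P zero    = [] ∷ []
tuples P (suc ℓ) = concatMap (λ p → map (p ∷_) (tuples P ℓ)) P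

∈-tuples : ∀ {X : Set} (P : List X) ps → All (_∈ P) ps → ps ∈ tuples P (length ps)
∈-tuples P []       []         = here refl
∈-tuples P (p ∷ ps) (p∈ ∷ ps⊆) =
  ∈-concatMap⁺ (λ p → map (p ∷_) (tuples P (length ps))) (Any.map (λ { refl → ∈-map⁺ (p ∷_) (∈-tuples P ps ps⊆) }) p∈)

_≟ₚ_ : (a b : Pt) → Dec (a ≡ b)
pt x     ≟ₚ pt y       with x ≟ y
... | yes refl = yes refl
... | no x≢y   = no (x≢y ∘ pt-injective)
nset w   ≟ₚ nset w′    with w ≟ₗ w′
... | yes refl = yes refl
... | no w≢w′  = no (w≢w′ ∘ nset-injective)
pair w b ≟ₚ pair w′ b′ with w ≟ₗ w′ | b ≟B b′
... | yes refl | yes refl = yes refl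
... | no w≢w′  | _        = no (w≢w′ ∘ proj₁ ∘ pair-injective)
... | _        | no b≢b′  = no (b≢b′ ∘ proj₂ ∘ pair-injective)
pt _     ≟ₚ nset _     = no λ ()
pt _     ≟ₚ pair _ _   = no λ ()
nset _   ≟ₚ pt _       = no λ ()
nset _   ≟ₚ pair _ _   = no λ ()
pair _ _ ≟ₚ pt _       = no λ ()
pair _ _ ≟ₚ nset _     = no λ ()

-- g is determined modulo Aut(M_n/cl A) by its values on S = supp A, which lie in
-- S, and by β*(fn g) on [S]^n, which is β* of the indicator of a set of subsets of S.
Fixes-cl-finite-index : ∀ n A → All (Valid n) A → FiniteIndexIn n (Fixes n (cl A)) (Fixes n (InList A))
Fixes-cl-finite-index n A vA = reps , All.tabulate (λ r∈ → fixes-A (proj₂ (∈-filter⁻ fixes-A? {xs = candidates} r∈)))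
                             , λ g g-fixes → let open Coset g g-fixes in r , r∈reps , r⁻¹g , r⁻¹g-fixes-cl , g≡r·r⁻¹g
  where
  S  = supp A
  S′ = enumerate S
  S′-incr = enumerate-incr S
  keys = sublists S′

  indicator : List (List ℕ) → Fn
  indicator T u = does (u ∈ₗ? T)

  candidate : List (ℕ × ℕ) → List (List ℕ) → Elt
  candidate ps T = mkElt (indicator T) (transpositions ps)

  candidates : List Elt
  candidates = concatMap (λ ps → map (candidate ps) (sublists keys)) (tuples (cartesianProduct S′ S′) (length S′))

  fixes-A? : ∀ e → Dec (All (λ a → act e a ≡ a) A)
  fixes-A? e = all? (λ a → act e a ≟ₚ a) A

  fixes-A : ∀ {e} → All (λ a → act e a ≡ a) A → Fixes n (InList A) e
  fixes-A fixed a _ a∈ = All.lookup fixed a∈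

  reps : List Elt
  reps = filter fixes-A? candidates

  module Coset (g : Elt) (g-fixes : Fixes n (InList A) g) where
    ps = matching (app (perm g)) S′
    ρ  = transpositions ps
    T  = filter (λ u → fn g u ≟B true) keys
    r  = candidate ps T

    ρ≗g : ∀ x → x ∈ S′ → app ρ x ≡ app (perm g) x
    ρ≗g = matching-agrees (app (perm g)) (app-injective (perm g)) (incr⇒unique S′-incr)

    ps⊆S′ : All (λ (a , b) → a ∈ S′ × b ∈ S′) ps
    ps⊆S′ = matching-all _ (app (perm g)) S′ λ qs qs⊆ x x∈ →
      transpositions-preserves qs qs⊆ x x∈ , ∈-enumerate⁺ (Fixes-A-preserves-supp vA g g-fixes x (∈-enumerate⁻ x∈))

    indicator≗fn : ∀ u → u ∈ keys → indicator T u ≡ fn g u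
    indicator≗fn u u∈ with fn g u in eq
    ... | true  = dec-true (u ∈ₗ? T) (∈-filter⁺ (λ u → fn g u ≟B true) u∈ eq)
    ... | false = dec-false (u ∈ₗ? T) λ u∈T →
      case trans (sym eq) (proj₂ (∈-filter⁻ (λ u → fn g u ≟B true) {xs = keys} u∈T)) of λ ()

    β-indicator≗β-fn : ∀ w → Incr w → All (_∈ S′) w → betaStar (indicator T) w ≡ betaStar (fn g) w
    β-indicator≗β-fn w p w⊆ = betaStar-cong _ _ w λ u u∈ →
      indicator≗fn u (∈-sublists⁺ S′-incr (removals-incr p u∈) (All.tabulate λ z∈ → All.lookup w⊆ (removals-⊆ p u∈ z∈)))

    r≗g : ∀ a → Valid n a → All (_∈ S) (suppPt a) → act r a ≡ act g a
    r≗g a va a⊆ = act-agree _ _ ρ (perm g) a va (λ x x∈ → ρ≗g x (∈-enumerate⁺ (All.lookup a⊆ x∈)))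
      (λ w mw w⊆ → β-indicator≗β-fn w (proj₁ mw) (All.map (∈-enumerate⁺ ∘ All.lookup a⊆) w⊆))

    r∈reps : r ∈ reps
    r∈reps = ∈-filter⁺ fixes-A?
      (∈-concatMap⁺ (λ ps → map (candidate ps) (sublists keys))
        (Any.map (λ { refl → ∈-map⁺ (candidate ps) (filter∈sublists (λ u → fn g u ≟B true) keys) })
          (subst (λ ℓ → ps ∈ tuples (cartesianProduct S′ S′) ℓ) (length-matching (app (perm g)) S′)
            (∈-tuples _ ps (All.map (λ (a∈ , b∈) → ∈-cartesianProduct⁺ a∈ b∈) ps⊆S′)))))
      (All.tabulate λ {a} a∈ → trans (r≗g a (All.lookup vA a∈) (All.tabulate (∈-supp⁺ a∈))) (g-fixes a (All.lookup vA a∈) a∈))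

    r⁻¹g = r ⁻¹ · g

    r⁻¹g-fixes-cl : Fixes n (cl A) r⁻¹g
    r⁻¹g-fixes-cl = Equivalence.from (Fixes-cl⇔FixesClOf n A r⁻¹g) (σ-fixes , β-vanishes)
      where
      σ-fixes : ∀ x → x ∈ S → app (perm r⁻¹g) x ≡ x
      σ-fixes x x∈ = trans (sym (ρ≗g (app⁻¹ ρ x) (transpositions⁻¹-preserves ps ps⊆S′ x (∈-enumerate⁺ x∈)))) (app-app⁻¹ ρ x)
      β-vanishes : ∀ w → IsMSet n w → All (_∈ S) w → betaStar (fn r⁻¹g) w ≡ false
      β-vanishes w (p , _) w⊆ = begin
        betaStar (fn r⁻¹g) w
          ≡⟨ betaStar-xor (fn (r ⁻¹)) _ w ⟩
        betaStar (fn (r ⁻¹)) w xor betaStar (λ u → fn g (imgSet (invPerm ρ) u)) w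
          ≡⟨ cong₂ _xor_ (sym (betaStar-imgSet (invPerm ρ) (indicator T) p)) (sym (betaStar-imgSet (invPerm ρ) (fn g) p)) ⟩
        betaStar (indicator T) w′ xor betaStar (fn g) w′
          ≡⟨ cong (_xor betaStar (fn g) w′) (β-indicator≗β-fn w′ (imgSet-incr (invPerm ρ) p) w′⊆S′) ⟩
        betaStar (fn g) w′ xor betaStar (fn g) w′
          ≡⟨ xor-same (betaStar (fn g) w′) ⟩
        false ∎
        where
        open ≡-Reasoning
        w′ = imgSet (invPerm ρ) w
        w′⊆S′ : All (_∈ S′) w′
        w′⊆S′ = All.tabulate λ z∈ → case imgSet-∈⁻ (invPerm ρ) {w} z∈ of λ
          { (x , x∈ , refl) → transpositions⁻¹-preserves ps ps⊆S′ x (∈-enumerate⁺ (All.lookup w⊆ x∈)) }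

    g≡r·r⁻¹g : ∀ m → Valid n m → act g m ≡ act r⁻¹g (act r m)
    g≡r·r⁻¹g m vm = sym (trans (act-· n (r ⁻¹) g (act r m) (act-valid n r m vm)) (cong (act g) (act-⁻¹-act n r m vm)))

-- Powers in subgroups of finite index

infixr 8 _^_

_^_ : Elt → ℕ → Elt
y ^ zero  = ε
y ^ suc j = y ^ j · y

act-^-+ : ∀ n y a b m → Valid n m → act (y ^ (a + b)) m ≡ act (y ^ b) (act (y ^ a) m)
act-^-+ n y a zero m vm = begin
  act (y ^ (a + 0)) m    ≡⟨ cong (λ c → act (y ^ c) m) (+-identityʳ a) ⟩
  act (y ^ a) m          ≡⟨ sym (act-ε n _ (act-valid n (y ^ a) m vm)) ⟩
  act ε (act (y ^ a) m)  ∎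
  where open ≡-Reasoning
act-^-+ n y a (suc b) m vm = begin
  act (y ^ (a + suc b)) m              ≡⟨ cong (λ c → act (y ^ c) m) (+-suc a b) ⟩
  act (y ^ (a + b) · y) m              ≡⟨ act-· n (y ^ (a + b)) y m vm ⟩
  act y (act (y ^ (a + b)) m)          ≡⟨ cong (act y) (act-^-+ n y a b m vm) ⟩
  act y (act (y ^ b) (act (y ^ a) m))  ≡⟨ sym (act-· n (y ^ b) y _ (act-valid n (y ^ a) m vm)) ⟩
  act (y ^ suc b) (act (y ^ a) m)      ∎
  where open ≡-Reasoning

Fixes-^ : ∀ n X y → Fixes n X y → ∀ j → Fixes n X (y ^ j)
Fixes-^ n X y y-fixes zero    = Fixes-ε n X
Fixes-^ n X y y-fixes (suc j) = Fixes-· n X _ y (Fixes-^ n X y y-fixes j) y-fixes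

module Subgroup {n} {H K : Elt → Set} (H≤K : IsSubgroupOf n H K) where
  open IsSubgroupOf H≤K

  ∈-ε : H ε
  ∈-ε with hasId
  ... | e , e∈H , e≈ε = resp e ε e∈H (λ m vm → trans (e≈ε m vm) (sym (act-ε n m vm)))

  ∈-· : ∀ g h → H g → H h → H (g · h)
  ∈-· g h g∈H h∈H with hasMul g h g∈H h∈H
  ... | e , e∈H , e≈gh = resp e (g · h) e∈H (λ m vm → trans (e≈gh m vm) (sym (act-· n g h m vm)))

  ∈-^-* : ∀ y d → H (y ^ d) → ∀ c → H (y ^ (c * d))
  ∈-^-* y d yᵈ∈H zero    = ∈-ε
  ∈-^-* y d yᵈ∈H (suc c) with hasMul (y ^ d) (y ^ (c * d)) yᵈ∈H (∈-^-* y d yᵈ∈H c)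
  ... | e , e∈H , e≈ = resp e (y ^ (suc c * d)) e∈H (λ m vm → trans (e≈ m vm) (sym (act-^-+ n y d (c * d) m vm)))

  ∈-same-coset : ∀ r k₁ k h₁ h₂ → H h₁ → H h₂ →
    (∀ m → Valid n m → act k₁ m ≡ act h₁ (act r m)) →
    (∀ m → Valid n m → act k (act k₁ m) ≡ act h₂ (act r m)) → H k
  ∈-same-coset r k₁ k h₁ h₂ h₁∈H h₂∈H k₁≈rh₁ k₁k≈rh₂ with hasInv h₁ h₁∈H
  ... | h₁⁻¹ , h₁⁻¹∈H , h₁⁻¹h₁≈ε with hasMul h₁⁻¹ h₂ h₁⁻¹∈H h₂∈H
  ... | e , e∈H , e≈ = resp e k e∈H λ m vm →
    let q  = act (k₁ ⁻¹) m
        vq = act-valid n (k₁ ⁻¹) m vm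
        k₁q≡m = act-act-⁻¹ n k₁ m vm
    in begin
      act e m                               ≡⟨ e≈ m vm ⟩
      act h₂ (act h₁⁻¹ m)                   ≡⟨ cong (act h₂ ∘ act h₁⁻¹) (trans (sym k₁q≡m) (k₁≈rh₁ q vq)) ⟩
      act h₂ (act h₁⁻¹ (act h₁ (act r q)))  ≡⟨ cong (act h₂) (h₁⁻¹h₁≈ε (act r q) (act-valid n r q vq)) ⟩
      act h₂ (act r q)                      ≡⟨ sym (k₁k≈rh₂ q vq) ⟩
      act k (act k₁ q)                      ≡⟨ cong (act k) k₁q≡m ⟩
      act k m                               ∎
    where open ≡-Reasoning

∣! : ∀ {d k} → 1 ≤ d → d ≤ k → d ∣ k !
∣! {suc d} _ d<k = ∣-trans (divides (d !) (*-comm (suc d) (d !))) (m≤n⇒m!∣n! d<k)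

-- Among y⁰, …, y^k (k the index) two powers share a coset, so y^d ∈ H for some
-- 1 ≤ d ≤ k, and d ∣ k!.
finite-index⇒uniform-power : ∀ {n} {H K : Elt → Set} →
  (∀ y → K y → ∀ j → K (y ^ j)) → IsSubgroupOf n H K → FiniteIndexIn n H K →
  ∃ λ N → ∀ y → K y → H (y ^ suc N)
finite-index⇒uniform-power {n} {H} {K} K-^ H≤K (reps , _ , coset) =
  pred (k !) , λ y y∈K → subst (λ e → H (y ^ e)) (sym (suc-pred (k !) {{k !≢0}})) (∈-^-k! y y∈K)
  where
  open Subgroup H≤K
  k = length reps
  ∈-^-k! : ∀ y → K y → H (y ^ (k !))
  ∈-^-k! y y∈K with Fin.pigeonhole (n<1+n k) (λ i → index (r∈reps i))
    where
    r∈reps : ∀ (i : Fin (suc k)) → _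
    r∈reps i = proj₁ (proj₂ (coset (y ^ toℕ i) (K-^ y y∈K (toℕ i))))
  ... | i , j , i<j , same-index with coset (y ^ toℕ i) (K-^ y y∈K (toℕ i)) | coset (y ^ toℕ j) (K-^ y y∈K (toℕ j))
  ...   | rᵢ , rᵢ∈ , hᵢ , hᵢ∈H , yⁱ≈ | rⱼ , rⱼ∈ , hⱼ , hⱼ∈H , yʲ≈ =
    subst (λ e → H (y ^ e)) (sym (_∣_.equality d∣k!)) (∈-^-* y d yᵈ∈H (_∣_.quotient d∣k!))
    where
    d = toℕ j ∸ toℕ i
    i+d≡j : toℕ i + d ≡ toℕ j
    i+d≡j = m+[n∸m]≡n (<⇒≤ i<j)
    rᵢ≡rⱼ : rᵢ ≡ rⱼ
    rᵢ≡rⱼ = trans (lookup-index rᵢ∈) (trans (cong (lookup reps) same-index) (sym (lookup-index rⱼ∈)))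
    yᵈ∈H : H (y ^ d)
    yᵈ∈H = ∈-same-coset rᵢ (y ^ toℕ i) (y ^ d) hᵢ hⱼ hᵢ∈H hⱼ∈H yⁱ≈ λ m vm → begin
      act (y ^ d) (act (y ^ toℕ i) m)  ≡⟨ sym (act-^-+ n y (toℕ i) d m vm) ⟩
      act (y ^ (toℕ i + d)) m          ≡⟨ cong (λ e → act (y ^ e) m) i+d≡j ⟩
      act (y ^ toℕ j) m                ≡⟨ yʲ≈ m vm ⟩
      act hⱼ (act rⱼ m)                ≡⟨ cong (λ r → act hⱼ (act r m)) (sym rᵢ≡rⱼ) ⟩
      act hⱼ (act rᵢ m)                ∎
      where open ≡-Reasoning
    d∣k! : d ∣ k !
    d∣k! = ∣! (m<n⇒0<n∸m i<j) (≤-trans (m∸n≤m (toℕ j) (toℕ i)) (≤-pred (Fin.toℕ<n j)))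

-- Cycles

opaque
  rot : ℕ → ℕ → ℕ
  rot K d with d <? K
  ... | yes _ = suc d
  ... | no _ with d ≟ K
  ...   | yes _ = 0
  ...   | no _  = d

  rot⁻¹ : ℕ → ℕ → ℕ
  rot⁻¹ K zero = K
  rot⁻¹ K (suc d) with d <? K
  ... | yes _ = d
  ... | no _  = suc d

  rot-< : ∀ K d → d < K → rot K d ≡ suc d
  rot-< K d d<K with d <? K
  ... | yes _  = refl
  ... | no d≮K = ⊥-elim (d≮K d<K)

  rot-≡ : ∀ K → rot K K ≡ 0
  rot-≡ K with K <? K
  ... | yes K<K = ⊥-elim (<-irrefl refl K<K)
  ... | no _ with K ≟ K
  ...   | yes _  = refl
  ...   | no K≢K = ⊥-elim (K≢K refl)

  rot-> : ∀ K d → K < d → rot K d ≡ d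
  rot-> K d K<d with d <? K
  ... | yes d<K = ⊥-elim (<-asym d<K K<d)
  ... | no _ with d ≟ K
  ...   | yes refl = ⊥-elim (<-irrefl refl K<d)
  ...   | no _     = refl

  rot⁻¹-suc-< : ∀ K d → d < K → rot⁻¹ K (suc d) ≡ d
  rot⁻¹-suc-< K d d<K with d <? K
  ... | yes _  = refl
  ... | no d≮K = ⊥-elim (d≮K d<K)

  rot⁻¹-suc-≮ : ∀ K d → ¬ d < K → rot⁻¹ K (suc d) ≡ suc d
  rot⁻¹-suc-≮ K d d≮K with d <? K
  ... | yes d<K = ⊥-elim (d≮K d<K)
  ... | no _    = refl

  rot⁻¹-zero : ∀ K → rot⁻¹ K 0 ≡ K
  rot⁻¹-zero K = refl

rot⁻¹-rot : ∀ K d → rot⁻¹ K (rot K d) ≡ d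
rot⁻¹-rot K d with <-cmp d K
... | tri< d<K _ _ = trans (cong (rot⁻¹ K) (rot-< K d d<K)) (rot⁻¹-suc-< K d d<K)
... | tri≈ _ refl _ = trans (cong (rot⁻¹ K) (rot-≡ K)) (rot⁻¹-zero K)
... | tri> _ _ K<d@(s≤s K≤d′) = trans (cong (rot⁻¹ K) (rot-> K d K<d)) (rot⁻¹-suc-≮ K _ (λ d′<K → <-irrefl refl (<-≤-trans d′<K K≤d′)))

rot-rot⁻¹ : ∀ K d → rot K (rot⁻¹ K d) ≡ d
rot-rot⁻¹ K zero = trans (cong (rot K) (rot⁻¹-zero K)) (rot-≡ K)
rot-rot⁻¹ K (suc d) with d <? K
... | yes d<K = trans (cong (rot K) (rot⁻¹-suc-< K d d<K)) (rot-< K d d<K)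
... | no d≮K  = trans (cong (rot K) (rot⁻¹-suc-≮ K d d≮K)) (rot-> K (suc d) (s≤s (≮⇒≥ d≮K)))

opaque
  rotAt : ℕ → ℕ → ℕ → ℕ
  rotAt M K z with z <? M
  ... | yes _ = z
  ... | no _  = M + rot K (z ∸ M)

  rotAt⁻¹ : ℕ → ℕ → ℕ → ℕ
  rotAt⁻¹ M K z with z <? M
  ... | yes _ = z
  ... | no _  = M + rot⁻¹ K (z ∸ M)

  rotAt-< : ∀ M K z → z < M → rotAt M K z ≡ z
  rotAt-< M K z z<M with z <? M
  ... | yes _  = refl
  ... | no z≮M = ⊥-elim (z≮M z<M)

  rotAt-+ : ∀ M K d → rotAt M K (M + d) ≡ M + rot K d
  rotAt-+ M K d with (M + d) <? M
  ... | yes M+d<M = ⊥-elim (<-irrefl refl (<-≤-trans M+d<M (m≤m+n M d)))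
  ... | no _      = cong (λ x → M + rot K x) (m+n∸m≡n M d)

  rotAt⁻¹-< : ∀ M K z → z < M → rotAt⁻¹ M K z ≡ z
  rotAt⁻¹-< M K z z<M with z <? M
  ... | yes _  = refl
  ... | no z≮M = ⊥-elim (z≮M z<M)

  rotAt⁻¹-+ : ∀ M K d → rotAt⁻¹ M K (M + d) ≡ M + rot⁻¹ K d
  rotAt⁻¹-+ M K d with (M + d) <? M
  ... | yes M+d<M = ⊥-elim (<-irrefl refl (<-≤-trans M+d<M (m≤m+n M d)))
  ... | no _      = cong (λ x → M + rot⁻¹ K x) (m+n∸m≡n M d)

below-or-above : ∀ M z → z < M ⊎ ∃ λ d → z ≡ M + d
below-or-above M z with z <? M
... | yes z<M = inj₁ z<M
... | no z≮M  = inj₂ (z ∸ M , sym (m+[n∸m]≡n (≮⇒≥ z≮M)))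

rotation : ℕ → ℕ → Perm
rotation M K = mk↔ₛ′ (rotAt M K) (rotAt⁻¹ M K) inverseˡ inverseʳ
  where
  inverseˡ : ∀ z → rotAt M K (rotAt⁻¹ M K z) ≡ z
  inverseˡ z with below-or-above M z
  ... | inj₁ z<M = trans (cong (rotAt M K) (rotAt⁻¹-< M K z z<M)) (rotAt-< M K z z<M)
  ... | inj₂ (d , refl) = trans (cong (rotAt M K) (rotAt⁻¹-+ M K d)) (trans (rotAt-+ M K _) (cong (M +_) (rot-rot⁻¹ K d)))
  inverseʳ : ∀ z → rotAt⁻¹ M K (rotAt M K z) ≡ z
  inverseʳ z with below-or-above M z
  ... | inj₁ z<M = trans (cong (rotAt⁻¹ M K) (rotAt-< M K z z<M)) (rotAt⁻¹-< M K z z<M)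
  ... | inj₂ (d , refl) = trans (cong (rotAt⁻¹ M K) (rotAt-+ M K d)) (trans (rotAt⁻¹-+ M K _) (cong (M +_) (rot⁻¹-rot K d)))

infixr 8 _^ₚ_

_^ₚ_ : Perm → ℕ → Perm
τ ^ₚ zero  = idPerm
τ ^ₚ suc j = τ ^ₚ j ⨾ τ

-- π ρ π⁻¹, acting as π, then ρ, then π⁻¹.
conjugate : Perm → Perm → Perm
conjugate π ρ = π ⨾ ρ ⨾ invPerm π

app-conjugate-^ : ∀ π ρ j z → app (conjugate π ρ ^ₚ j) z ≡ app⁻¹ π (app (ρ ^ₚ j) (app π z))
app-conjugate-^ π ρ zero    z = sym (app⁻¹-app π z)
app-conjugate-^ π ρ (suc j) z =
  trans (cong (app⁻¹ π ∘ app ρ ∘ app π) (app-conjugate-^ π ρ j z)) (cong (app⁻¹ π ∘ app ρ) (app-app⁻¹ π _))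

rotation-^-< : ∀ M K j z → z < M → app (rotation M K ^ₚ j) z ≡ z
rotation-^-< M K zero    z z<M = refl
rotation-^-< M K (suc j) z z<M = trans (cong (rotAt M K) (rotation-^-< M K j z z<M)) (rotAt-< M K z z<M)

rotation-^-+ : ∀ M K j i → i + j ≤ K → app (rotation M K ^ₚ j) (M + i) ≡ M + (i + j)
rotation-^-+ M K zero    i _     = cong (M +_) (sym (+-identityʳ i))
rotation-^-+ M K (suc j) i i+j<K = begin
  rotAt M K (app (rotation M K ^ₚ j) (M + i))  ≡⟨ cong (rotAt M K) (rotation-^-+ M K j i (≤-trans (+-monoʳ-≤ i (n≤1+n j)) i+j<K)) ⟩
  rotAt M K (M + (i + j))                      ≡⟨ rotAt-+ M K (i + j) ⟩
  M + rot K (i + j)                            ≡⟨ cong (M +_) (rot-< K (i + j) (subst (_≤ K) (+-suc i j) i+j<K)) ⟩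
  M + suc (i + j)                              ≡⟨ cong (M +_) (sym (+-suc i j)) ⟩
  M + (i + suc j)                              ∎
  where open ≡-Reasoning

rotAt-last : ∀ M K → rotAt M K (M + K) ≡ M
rotAt-last M K = trans (rotAt-+ M K K) (trans (cong (M +_) (rot-≡ K)) (+-identityʳ M))

-- For a, b < M, conjugating the cycle (M ⋯ M+2N+1) by (a M)(b M+N+1) gives a cycle of
-- length 2(N+1) through a and b at distance N+1, whose (N+1)-st power is (a b) below M.
module TranspositionAsPower (N′ a b M : ℕ) (a<M : a < M) (b<M : b < M) (a≢b : a ≢ b) where
  N = suc N′
  π = transposition a M ⨾ transposition b (M + N)
  R = rotation M (N + N′)
  ρ = conjugate π R

  z<M⇒z≢M : ∀ {z} → z < M → z ≢ M
  z<M⇒z≢M z<M z≡M = <-irrefl z≡M z<M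
  z<M⇒z≢M+N : ∀ {z} → z < M → z ≢ M + N
  z<M⇒z≢M+N z<M z≡ = <-irrefl z≡ (<-≤-trans z<M (m≤m+n M N))
  M≢M+N : M ≢ M + N
  M≢M+N M≡ = <-irrefl M≡ (subst (M <_) (sym (+-suc M N′)) (s≤s (m≤m+n M N′)))

  ρ^-fixes : ∀ j z → z < M → z ≢ a → z ≢ b → app (ρ ^ₚ j) z ≡ z
  ρ^-fixes j z z<M z≢a z≢b = begin
    app (ρ ^ₚ j) z                    ≡⟨ app-conjugate-^ π R j z ⟩
    app⁻¹ π (app (R ^ₚ j) (app π z))  ≡⟨ cong (λ x → app⁻¹ π (app (R ^ₚ j) x)) πz≡z ⟩
    app⁻¹ π (app (R ^ₚ j) z)          ≡⟨ cong (app⁻¹ π) (rotation-^-< M (N + N′) j z z<M) ⟩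
    app⁻¹ π z                         ≡⟨ cong (swapℕ a M) (swapℕ-other b (M + N) z z≢b (z<M⇒z≢M+N z<M)) ⟩
    swapℕ a M z                       ≡⟨ swapℕ-other a M z z≢a (z<M⇒z≢M z<M) ⟩
    z                                 ∎
    where
    open ≡-Reasoning
    πz≡z : app π z ≡ z
    πz≡z = trans (cong (swapℕ b (M + N)) (swapℕ-other a M z z≢a (z<M⇒z≢M z<M))) (swapℕ-other b (M + N) z z≢b (z<M⇒z≢M+N z<M))

  ρ^N-a : app (ρ ^ₚ N) a ≡ b
  ρ^N-a = begin
    app (ρ ^ₚ N) a                    ≡⟨ app-conjugate-^ π R N a ⟩
    app⁻¹ π (app (R ^ₚ N) (app π a))  ≡⟨ cong (λ x → app⁻¹ π (app (R ^ₚ N) x)) (trans πa≡M (sym (+-identityʳ M))) ⟩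
    app⁻¹ π (app (R ^ₚ N) (M + 0))    ≡⟨ cong (app⁻¹ π) (rotation-^-+ M (N + N′) N 0 (m≤m+n N N′)) ⟩
    app⁻¹ π (M + N)                   ≡⟨ cong (swapℕ a M) (swapℕ-b b (M + N)) ⟩
    swapℕ a M b                       ≡⟨ swapℕ-other a M b (a≢b ∘ sym) (z<M⇒z≢M b<M) ⟩
    b                                 ∎
    where
    open ≡-Reasoning
    πa≡M : app π a ≡ M
    πa≡M = trans (cong (swapℕ b (M + N)) (swapℕ-a a M)) (swapℕ-other b (M + N) M (z<M⇒z≢M b<M ∘ sym) M≢M+N)

  ρ^N-b : app (ρ ^ₚ N) b ≡ a
  ρ^N-b = begin
    app (ρ ^ₚ N) b                             ≡⟨ app-conjugate-^ π R N b ⟩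
    app⁻¹ π (app (R ^ₚ N) (app π b))           ≡⟨ cong (λ x → app⁻¹ π (app (R ^ₚ N) x)) πb≡M+N ⟩
    app⁻¹ π (app (R ^ₚ N) (M + N))             ≡⟨ cong (λ x → app⁻¹ π (rotAt M (N + N′) x)) (rotation-^-+ M (N + N′) N′ N ≤-refl) ⟩
    app⁻¹ π (rotAt M (N + N′) (M + (N + N′)))  ≡⟨ cong (app⁻¹ π) (rotAt-last M (N + N′)) ⟩
    app⁻¹ π M                                  ≡⟨ cong (swapℕ a M) (swapℕ-other b (M + N) M (z<M⇒z≢M b<M ∘ sym) M≢M+N) ⟩
    swapℕ a M M                                ≡⟨ swapℕ-b a M ⟩
    a                                          ∎
    where
    open ≡-Reasoning
    πb≡M+N : app π b ≡ M + N
    πb≡M+N = trans (cong (swapℕ b (M + N)) (swapℕ-other a M b (a≢b ∘ sym) (z<M⇒z≢M b<M))) (swapℕ-a b (M + N))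

  ρ^N≗transposition : ∀ z → z < M → app (ρ ^ₚ N) z ≡ swapℕ a b z
  ρ^N≗transposition z z<M = swapℕ-cases {λ y → app (ρ ^ₚ N) z ≡ y} a b z
    (λ { refl → ρ^N-a }) (λ { refl → ρ^N-b }) (ρ^-fixes N z z<M)

-- Conjugating the cycle (M ⋯ M+N′) by (x M) gives a cycle of length N′+1 through x.
module CycleThrough (N′ x M : ℕ) (x<M : x < M) where
  N = suc N′
  π = transposition x M
  R = rotation M N′
  τ = conjugate π R

  τ^-fixes : ∀ j z → z < M → z ≢ x → app (τ ^ₚ j) z ≡ z
  τ^-fixes j z z<M z≢x = begin
    app (τ ^ₚ j) z                          ≡⟨ app-conjugate-^ π R j z ⟩
    swapℕ x M (app (R ^ₚ j) (swapℕ x M z))  ≡⟨ cong (swapℕ x M ∘ app (R ^ₚ j)) x≢ ⟩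
    swapℕ x M (app (R ^ₚ j) z)              ≡⟨ cong (swapℕ x M) (rotation-^-< M N′ j z z<M) ⟩
    swapℕ x M z                             ≡⟨ x≢ ⟩
    z                                       ∎
    where
    open ≡-Reasoning
    x≢ = swapℕ-other x M z z≢x (λ z≡M → <-irrefl z≡M z<M)

  τ^-x : ∀ j → suc j ≤ N′ → app (τ ^ₚ suc j) x ≡ M + suc j
  τ^-x j j<N′ = begin
    app (τ ^ₚ suc j) x                          ≡⟨ app-conjugate-^ π R (suc j) x ⟩
    swapℕ x M (app (R ^ₚ suc j) (swapℕ x M x))  ≡⟨ cong (swapℕ x M ∘ app (R ^ₚ suc j)) (trans (swapℕ-a x M) (sym (+-identityʳ M))) ⟩
    swapℕ x M (app (R ^ₚ suc j) (M + 0))        ≡⟨ cong (swapℕ x M) (rotation-^-+ M N′ (suc j) 0 j<N′) ⟩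
    swapℕ x M (M + suc j)                       ≡⟨ swapℕ-other x M (M + suc j) (λ e → <-irrefl (sym e) (<-≤-trans x<M (m≤m+n M (suc j))))
                                                                     (λ e → <-irrefl (sym e) (subst (M <_) (sym (+-suc M j)) (s≤s (m≤m+n M j)))) ⟩
    M + suc j                                                    ∎
    where open ≡-Reasoning

  τ^N-x : app (τ ^ₚ N) x ≡ x
  τ^N-x = begin
    app (τ ^ₚ N) x                                  ≡⟨ app-conjugate-^ π R N x ⟩
    swapℕ x M (app (R ^ₚ N) (swapℕ x M x))          ≡⟨ cong (swapℕ x M ∘ app (R ^ₚ N)) (trans (swapℕ-a x M) (sym (+-identityʳ M))) ⟩
    swapℕ x M (rotAt M N′ (app (R ^ₚ N′) (M + 0)))  ≡⟨ cong (swapℕ x M ∘ rotAt M N′) (rotation-^-+ M N′ N′ 0 ≤-refl) ⟩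
    swapℕ x M (rotAt M N′ (M + N′))                 ≡⟨ cong (swapℕ x M) (rotAt-last M N′) ⟩
    swapℕ x M M                                     ≡⟨ swapℕ-b x M ⟩
    x                                               ∎
    where open ≡-Reasoning

  τ^N-fixes : ∀ z → z < M → app (τ ^ₚ N) z ≡ z
  τ^N-fixes z z<M with z ≟ x
  ... | yes refl = τ^N-x
  ... | no z≢x   = τ^-fixes N z z<M z≢x

zeroFn : Fn
zeroFn _ = false

-- The F₂-part acquired by a pair (w , b) under (φ , τ)^j.
cocycle : Fn → Perm → List ℕ → ℕ → Bool
cocycle φ τ w zero    = false
cocycle φ τ w (suc j) = cocycle φ τ w j xor betaStar φ (imgSet (τ ^ₚ j) w)

cocycle-zeroFn : ∀ τ w j → cocycle zeroFn τ w j ≡ false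
cocycle-zeroFn τ w zero    = refl
cocycle-zeroFn τ w (suc j) = trans (cong (_xor betaStar zeroFn (imgSet (τ ^ₚ j) w)) (cocycle-zeroFn τ w j)) (betaStar-zero (imgSet (τ ^ₚ j) w))

act-^-pt : ∀ φ τ j x → act (mkElt φ τ ^ j) (pt x) ≡ pt (app (τ ^ₚ j) x)
act-^-pt φ τ zero    x = refl
act-^-pt φ τ (suc j) x = cong (act (mkElt φ τ)) (act-^-pt φ τ j x)

act-^-nset : ∀ {n} φ τ j {w} → IsMSet n w → act (mkElt φ τ ^ j) (nset w) ≡ nset (imgSet (τ ^ₚ j) w)
act-^-nset φ τ zero    mw = refl
act-^-nset φ τ (suc j) {w} mw = trans (act-· _ (mkElt φ τ ^ j) (mkElt φ τ) (nset w) mw)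
  (trans (cong (act (mkElt φ τ)) (act-^-nset φ τ j mw)) (cong nset (sym (imgSet-⨾ (τ ^ₚ j) τ (proj₁ mw)))))

act-^-pair : ∀ {n} φ τ j {w} b → IsMSet n w → act (mkElt φ τ ^ j) (pair w b) ≡ pair (imgSet (τ ^ₚ j) w) (b xor cocycle φ τ w j)
act-^-pair φ τ zero    {w} b mw = cong (pair (imgSet idPerm w)) (cong (b xor_) (betaStar-zero w))
act-^-pair φ τ (suc j) {w} b mw = trans (act-· _ (mkElt φ τ ^ j) (mkElt φ τ) (pair w b) mw)
  (trans (cong (act (mkElt φ τ)) (act-^-pair φ τ j b mw))
         (cong₂ pair (sym (imgSet-⨾ (τ ^ₚ j) τ (proj₁ mw))) (xor-assoc b _ _)))

power-agrees-below : ∀ {n} φ τ j t M →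
  (∀ z → z < M → app (τ ^ₚ j) z ≡ app (perm t) z) →
  (∀ w → IsMSet n w → All (_< M) w → cocycle φ τ w j ≡ betaStar (fn t) w) →
  ∀ m → Valid n m → All (_< M) (suppPt m) → act (mkElt φ τ ^ j) m ≡ act t m
power-agrees-below φ τ j t M perm≗ cocycle≗ (pt x) _ (x<M ∷ []) =
  trans (act-^-pt φ τ j x) (cong pt (perm≗ x x<M))
power-agrees-below φ τ j t M perm≗ cocycle≗ (nset w) mw w<M =
  trans (act-^-nset φ τ j mw) (cong nset (imgSet-cong (τ ^ₚ j) (perm t) (proj₁ mw) (λ z z∈ → perm≗ z (All.lookup w<M z∈))))
power-agrees-below φ τ j t M perm≗ cocycle≗ (pair w b) mw w<M = trans (act-^-pair φ τ j b mw)
  (cong₂ pair (imgSet-cong (τ ^ₚ j) (perm t) (proj₁ mw) (λ z z∈ → perm≗ z (All.lookup w<M z∈))) (cong (b xor_) (cocycle≗ w mw w<M)))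

act-agree-on-msets : ∀ {m} φ ψ σ τ → (∀ z → app σ z ≡ app τ z) → (∀ r → IsMSet m r → φ r ≡ ψ r) →
  ∀ x → Valid (suc m) x → act (mkElt φ σ) x ≡ act (mkElt ψ τ) x
act-agree-on-msets φ ψ σ τ σ≗τ φ≗ψ x vx = act-agree φ ψ σ τ x vx (λ z _ → σ≗τ z)
  (λ w mw _ → betaStar-cong φ ψ w λ r r∈ → φ≗ψ r (removals-mset mw r∈))

δ : List ℕ → Fn
δ u r = does (r ≟ₗ u)

betaStar-δ-∌ : ∀ u x w → x ∈ u → Incr w → x ∉ w → betaStar (δ u) w ≡ false
betaStar-δ-∌ u x w x∈u p x∉w = xorSum-false (δ u) (removals w) (All.tabulate λ {r} r∈ →
  dec-false (r ≟ₗ u) λ { refl → x∉w (removals-⊆ p r∈ x∈u) })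

-- Along the cycle through x, only the first term of the cocycle survives below M.
cocycle-δ-cycle : ∀ N′ x M (x<M : x < M) u → x ∈ u → ∀ {n} w → IsMSet n w → All (_< M) w →
  cocycle (δ u) (CycleThrough.τ N′ x M x<M) w (suc N′) ≡ betaStar (δ u) w
cocycle-δ-cycle N′ x M x<M u x∈u w (p , _) w<M = only-first-term N′ ≤-refl
  where
  open CycleThrough N′ x M x<M using (τ; τ^-x; τ^-fixes)
  x∉τʲw : ∀ j → suc j ≤ N′ → x ∉ imgSet (τ ^ₚ suc j) w
  x∉τʲw j j<N′ x∈ with imgSet-∈⁻ (τ ^ₚ suc j) {w} x∈
  ... | z , z∈ , x≡ with z ≟ x
  ...   | yes refl = <-irrefl (trans x≡ (τ^-x j j<N′)) (<-≤-trans x<M (m≤m+n M (suc j)))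
  ...   | no z≢x   = z≢x (trans (sym (τ^-fixes (suc j) z (All.lookup w<M z∈) z≢x)) (sym x≡))
  only-first-term : ∀ j → j ≤ N′ → cocycle (δ u) τ w (suc j) ≡ betaStar (δ u) w
  only-first-term zero    _     = cong (betaStar (δ u)) (imgSet-fixed idPerm p (λ _ _ → refl))
  only-first-term (suc j) j<N′ = trans
    (cong₂ _xor_ (only-first-term j (≤-trans (n≤1+n j) j<N′))
                 (betaStar-δ-∌ u x _ x∈u (imgSet-incr (τ ^ₚ suc j) p) (x∉τʲw j j<N′)))
    (xor-identityʳ _)

-- Minimality

-- Given that H is closed and contains (N+1)-st powers of all elements of Aut(M_n/A),
-- it contains the transpositions and the translations β*δ_u that generate Aut(M_n/cl A).
module Minimality {m : ℕ} (A : List Pt) {H : Elt → Set}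
  (H≤K : IsSubgroupOf (suc m) H (Fixes (suc m) (InList A))) (H-closed : IsClosed (suc m) H)
  (N′ : ℕ) (powers∈H : ∀ y → Fixes (suc m) (InList A) y → H (y ^ suc N′)) where

  open Subgroup H≤K
  open IsSubgroupOf H≤K using (resp)

  n = suc m
  N = suc N′
  S = supp A

  FixesClOf⇒Fixes-A : ∀ y → FixesClOf n S y → Fixes n (InList A) y
  FixesClOf⇒Fixes-A y fixes a va a∈ = Equivalence.from (Fixes-cl⇔FixesClOf n A y) fixes a va (A⊆cl a∈)

  ∈H-if-approximated : ∀ t → (∀ L → All (Valid n) L →
    Σ Elt λ y → Fixes n (InList A) y × (∀ x → x ∈ L → Valid n x → act (y ^ N) x ≡ act t x)) → H t
  ∈H-if-approximated t approx = H-closed t λ L vL → case approx L vL of λ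
    { (y , y-fixes , yᴺ≈t) → y ^ N , powers∈H y y-fixes , All.tabulate (λ {x} x∈ → yᴺ≈t x x∈ (All.lookup vL x∈)) }

  bound : List Pt → List ℕ → ℕ
  bound L E = suc (max (supp L ++ (S ++ E)))

  <bound-L : ∀ L E {x z} → x ∈ L → z ∈ suppPt x → z < bound L E
  <bound-L L E x∈ z∈ = s≤s (∈⇒≤max (∈-++⁺ˡ (∈-supp⁺ x∈ z∈)))

  <bound-S : ∀ L E {z} → z ∈ S → z < bound L E
  <bound-S L E z∈ = s≤s (∈⇒≤max (∈-++⁺ʳ (supp L) (∈-++⁺ˡ z∈)))

  <bound-E : ∀ L E {z} → z ∈ E → z < bound L E
  <bound-E L E z∈ = s≤s (∈⇒≤max (∈-++⁺ʳ (supp L) (∈-++⁺ʳ S z∈)))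

  transposition∈H : ∀ a b → a ∉ S → b ∉ S → a ≢ b → H (mkElt zeroFn (transposition a b))
  transposition∈H a b a∉S b∉S a≢b = ∈H-if-approximated _ λ L vL →
    let E = a ∷ b ∷ []
        M = bound L E
        open TranspositionAsPower N′ a b M (<bound-E L E (here refl)) (<bound-E L E (there (here refl))) a≢b
          using (ρ; ρ^-fixes; ρ^N≗transposition)
    in mkElt zeroFn ρ
     , FixesClOf⇒Fixes-A _ ((λ x x∈ → ρ^-fixes 1 x (<bound-S L E x∈) (λ { refl → a∉S x∈ }) (λ { refl → b∉S x∈ }))
                          , λ w _ _ → betaStar-zero w)
     , λ x x∈ vx → power-agrees-below zeroFn ρ N _ M ρ^N≗transposition
         (λ w _ _ → trans (cocycle-zeroFn ρ w N) (sym (betaStar-zero w))) x vx (All.tabulate (<bound-L L E x∈))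

  δ∈H : ∀ u x → x ∈ u → x ∉ S → H (mkElt (δ u) idPerm)
  δ∈H u x x∈u x∉S = ∈H-if-approximated _ λ L vL →
    let M = bound L u
        x<M = <bound-E L u x∈u
        open CycleThrough N′ x M x<M using (τ; τ^-fixes; τ^N-fixes)
    in mkElt (δ u) τ
     , FixesClOf⇒Fixes-A _ ((λ z z∈ → τ^-fixes 1 z (<bound-S L u z∈) (λ { refl → x∉S z∈ }))
                          , λ w (p , _) w⊆ → betaStar-δ-∌ u x w x∈u p (x∉S ∘ All.lookup w⊆))
     , λ y y∈ vy → power-agrees-below (δ u) τ N _ M τ^N-fixes (λ w mw → cocycle-δ-cycle N′ x M x<M u x∈u w mw) y vy (All.tabulate (<bound-L L u y∈))

  OutsideS : ℕ × ℕ → Set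
  OutsideS (a , b) = a ≡ b ⊎ (a ∉ S × b ∉ S)

  transpositions-fix-S : ∀ ps → All OutsideS ps → ∀ z → z ∈ S → app (transpositions ps) z ≡ z
  transpositions-fix-S []             []       z z∈ = refl
  transpositions-fix-S ((a , b) ∷ ps) (q ∷ qs) z z∈ = trans (cong (swapℕ a b) (transpositions-fix-S ps qs z z∈)) (fixes-z q)
    where
    fixes-z : OutsideS (a , b) → swapℕ a b z ≡ z
    fixes-z (inj₁ refl)         = swapℕ-same a z
    fixes-z (inj₂ (a∉S , b∉S)) = swapℕ-other a b z (λ { refl → a∉S z∈ }) (λ { refl → b∉S z∈ })

  transpositions∈H : ∀ ps → All OutsideS ps → H (mkElt zeroFn (transpositions ps))
  transpositions∈H []             []       = ∈-ε
  transpositions∈H ((a , b) ∷ ps) (q ∷ qs) = ∈-· _ (mkElt zeroFn (transposition a b)) (transpositions∈H ps qs) (transposition∈H′ q)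
    where
    transposition∈H′ : OutsideS (a , b) → H (mkElt zeroFn (transposition a b))
    transposition∈H′ (inj₁ refl) = resp ε _ ∈-ε λ x vx → act-agree-on-msets _ _ _ _ (λ z → sym (swapℕ-same a z)) (λ _ _ → refl) x vx
    transposition∈H′ (inj₂ (a∉S , b∉S)) with a ≟ b
    ... | yes refl = transposition∈H′ (inj₁ refl)
    ... | no a≢b   = transposition∈H a b a∉S b∉S a≢b

  perm∈H : ∀ σ → (∀ x → x ∈ S → app σ x ≡ x) → H (mkElt zeroFn σ)
  perm∈H σ σ-fixes = H-closed _ λ L vL →
    let F  = enumerate (supp L)
        ps = matching (app σ) F
    in mkElt zeroFn (transpositions ps)
     , transpositions∈H ps (matching-all OutsideS (app σ) F λ qs qs-out x _ → outside qs qs-out x)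
     , All.tabulate λ {y} y∈ → act-agree _ _ _ σ y (All.lookup vL y∈)
         (λ z z∈ → matching-agrees (app σ) (app-injective σ) (incr⇒unique (enumerate-incr (supp L))) z (∈-enumerate⁺ (∈-supp⁺ y∈ z∈)))
         (λ _ _ _ → refl)
    where
    outside : ∀ qs → All OutsideS qs → ∀ x → OutsideS (app (transpositions qs) x , app σ x)
    outside qs qs-out x with x ∈? S
    ... | yes x∈S = inj₁ (trans (transpositions-fix-S qs qs-out x x∈S) (sym (σ-fixes x x∈S)))
    ... | no x∉S  = inj₂ ( (λ ρx∈S → x∉S (subst (_∈ S) (app-injective (transpositions qs) (transpositions-fix-S qs qs-out _ ρx∈S)) ρx∈S))
                         , (λ σx∈S → x∉S (subst (_∈ S) (app-injective σ (σ-fixes _ σx∈S)) σx∈S)))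

  module _ (v : Fn) (v-vanishes : ∀ u → IsMSet m u → All (_∈ S) u → v u ≡ false) where

    restrict : List (List ℕ) → Fn
    restrict Us r = xorSum (map (λ u → δ u r ∧ v u) Us)

    restrict∈H : ∀ Us → All Incr Us → H (mkElt (restrict Us) idPerm)
    restrict∈H []       []             = ∈-ε
    restrict∈H (u ∷ Us) (u-incr ∷ Us-incr) with v u in vu
    ... | false = resp _ _ (restrict∈H Us Us-incr) (act-agree-on-msets _ _ _ _ (λ _ → refl)
                    (λ r _ → cong (_xor restrict Us r) (sym (∧-zeroʳ (δ u r)))))
    ... | true with length u ≟ m
    ...   | no |u|≢m = resp _ _ (restrict∈H Us Us-incr) (act-agree-on-msets _ _ _ _ (λ _ → refl)
                    (λ r (_ , |r|≡m) → cong (_xor restrict Us r) (sym (trans (∧-identityʳ (δ u r))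
                       (dec-false (r ≟ₗ u) λ { refl → |u|≢m |r|≡m })))))
    ...   | yes |u|≡m with all? (_∈? S) u
    ...     | yes u⊆S = case trans (sym vu) (v-vanishes u (u-incr , |u|≡m) u⊆S) of λ ()
    ...     | no u⊈S with find (All.¬All⇒Any¬ (_∈? S) u u⊈S)
    ...       | x , x∈u , x∉S = resp _ _ (∈-· _ _ (restrict∈H Us Us-incr) (δ∈H u x x∈u x∉S))
                    (act-agree-on-msets _ _ _ _ (λ _ → refl) λ r (r-incr , _) →
                       trans (cong (restrict Us r xor_) (cong (δ u) (imgSet-fixed idPerm r-incr (λ _ _ → refl))))
                             (trans (xor-comm (restrict Us r) (δ u r)) (cong (_xor restrict Us r) (sym (∧-identityʳ (δ u r))))))

    restrict-sublists : ∀ s r → Incr s → Incr r → All (_∈ s) r → restrict (sublists s) r ≡ v r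
    restrict-sublists s r s-incr r-incr r⊆s = begin
      xorSum (map (λ u → δ u r ∧ v u) (sublists s))  ≡⟨ cong xorSum (map-cong∈ (sublists s) (λ u _ → δ∧v u (r ≟ₗ u))) ⟩
      xorSum (map (λ u → δ u r ∧ v r) (sublists s))  ≡⟨ xorSum-∧ʳ (λ u → δ u r) (v r) (sublists s) ⟩
      count₂ r (sublists s) ∧ v r                    ≡⟨ cong (_∧ v r) (count₂-sublists s-incr r-incr r⊆s) ⟩
      v r                                            ∎
      where
      open ≡-Reasoning
      δ∧v : ∀ u → Dec (r ≡ u) → δ u r ∧ v u ≡ δ u r ∧ v r
      δ∧v u (yes refl) = refl
      δ∧v u (no r≢u)   = trans (cong (_∧ v u) (dec-false (r ≟ₗ u) r≢u)) (sym (cong (_∧ v r) (dec-false (r ≟ₗ u) r≢u)))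

    translation∈H : H (mkElt v idPerm)
    translation∈H = H-closed _ λ L vL →
      let F = enumerate (supp L)
      in mkElt (restrict (sublists F)) idPerm
       , restrict∈H (sublists F) (All.tabulate (proj₁ ∘ ∈-sublists⁻ (enumerate-incr (supp L))))
       , All.tabulate λ {y} y∈ → act-agree _ _ _ _ y (All.lookup vL y∈) (λ _ _ → refl) λ w (p , _) w⊆ →
           betaStar-cong _ _ w λ r r∈ → restrict-sublists F r (enumerate-incr (supp L)) (removals-incr p r∈)
             (All.tabulate λ z∈ → ∈-enumerate⁺ (∈-supp⁺ y∈ (All.lookup w⊆ (removals-⊆ p r∈ z∈))))

Fixes-cl-minimal : ∀ k A → let n = suc (suc k) in
  (H : Elt → Set) → IsSubgroupOf n H (Fixes n (InList A)) → IsClosed n H →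
  FiniteIndexIn n H (Fixes n (InList A)) → (e : Elt) → Fixes n (cl A) e → H e
Fixes-cl-minimal k A H H≤K H-closed H-finite-index e e-fixes
  with finite-index⇒uniform-power (Fixes-^ _ (InList A)) H≤K H-finite-index
     | Equivalence.to (Fixes-cl⇔FixesClOf _ A e) e-fixes
... | N , powers∈H | σ-fixes , β-vanishes with vanishing-representative k (supp A) (fn e) β-vanishes
... | v , v-vanishes , β≡βv =
  -- e acts as the translation by β*v followed by the permutation perm e.
  resp _ e (∈-· _ _ (translation∈H v v-vanishes) (perm∈H (perm e) σ-fixes)) λ x vx →
    act-agree _ (fn e) _ (perm e) x vx (λ _ _ → refl) λ w (p , _) _ →
      trans (betaStar-cong _ v w λ u _ → xor-identityʳ (v u)) (sym (β≡βv w p))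
  where
  open Minimality A H≤K H-closed N powers∈H
  open Subgroup H≤K
  open IsSubgroupOf H≤K using (resp)

lemma4p3 : (n : ℕ) → 2 ≤ n → (A : List Pt) → All (Valid n) A →
    ((e : Elt) → Fixes n (cl A) e ⇔ InWSSym (n ∸ 1) (supp A) e)
    × IsSubgroupOf n (Fixes n (cl A)) (Fixes n (InList A))
    × IsClosed n (Fixes n (cl A))
    × FiniteIndexIn n (Fixes n (cl A)) (Fixes n (InList A))
    × ((H : Elt → Set) → IsSubgroupOf n H (Fixes n (InList A)) → IsClosed n H →
       FiniteIndexIn n H (Fixes n (InList A)) → (e : Elt) → Fixes n (cl A) e → H e)
lemma4p3 1 (s≤s ()) A vA
lemma4p3 (suc (suc k)) _ A vA =
    Fixes-cl⇔WS⋊Sym k A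
  , Fixes-subgroup _ (cl A) (InList A) (λ _ _ → A⊆cl)
  , Fixes-closed _ (cl A)
  , Fixes-cl-finite-index _ A vA
  , Fixes-cl-minimal k A
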